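{- Let $t\geq 3$ be an integer and let $0<\frac{1}{n_0}\ll d\ll \alpha\ll \beta\leq \frac{1}{t}$. Let $n$ and $N$ be positive integers with $n\geq n_0$ and $N\leq 3n$. Let $G$ be a $t$-partite graph on $N$ vertices with partition $\{V_1, \dots, V_t\}$ such that $\beta N\leq |V_1|\leq \dots \leq |V_t|$. If (i) $|V_2|+\dots+|V_t|\geq (2+\beta)n$, (ii) $|V_2|+\dots+|V_{t-1}|\geq (1+\beta)n$, and (iii) for all $1\leq i<j\leq t$, $e(V_i, V_j)\geq (1-d)|V_i||V_j|$, then $G$ contains a copy of $W_{2n}$.
   Context: For $k\ge 3$, the wheel $W_k$ is the graph on $k+1$ vertices obtained by joining one vertex to every vertex of a cycle of length $k$. A $t$-partite graph with partition $\{V_1,\dots,V_t\}$ has no edges inside any $V_i$; $e(V_i,V_j)$ is the number of edges between $V_i$ and $V_j$. The hierarchy notation $0<a\ll b\ll c\le 1$ means: there are non-decreasing functions $f,g:(0,1]\to(0,1]$ such that the statement holds for all $a,b,c$ with $b\le f(c)$ and $a\le g(b)$ (constants chosen from right to left); here $\frac1{n_0}\ll d\ll\alpha\ll\beta$ is read in the same way.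
   Formalization: The hierarchy constants β, α and d range only over the rationals. -}

module Defs where

open import Data.Nat using (ℕ; zero; suc; _+_; _≤_; _<_)
open import Data.Bool using (Bool; true; false; _∧_; _∨_; if_then_else_)
open import Data.Fin using (Fin; toℕ) renaming (zero to fzero; suc to fsuc)
open import Data.Fin.Properties using () renaming (_≟_ to _≟F_)
import Data.Nat.Properties as ℕP
open import Data.List using (List; map; filter; length; allFin)
open import Data.Nat.ListAction using (sum)
open import Data.Product using (Σ; _×_; _,_)
open import Relation.Binary.PropositionalEquality using (_≡_; _≢_)
open import Relation.Nullary.Decidable using (⌊_⌋)
open import Function.Definitions using (Injective)
open import Data.Integer using (+_)
open import Data.Rational using (ℚ; _/_)

ℕtoℚ : ℕ → ℚ
ℕtoℚ n = (+ n) / 1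

ΣFin : (t : ℕ) → (Fin t → ℕ) → ℕ
ΣFin t f = sum (map f (allFin t))

record SimpleGraph (N : ℕ) : Set where
  field
    adj    : Fin N → Fin N → Bool
    sym    : ∀ u v → adj u v ≡ adj v u
    irrefl : ∀ v → adj v v ≡ false
open SimpleGraph public

-- a partition of the vertices into t classes V_0,...,V_{t-1}
-- (paper's V_1..V_t), given by the class map; t-partite = no edge inside a class
IsPartite : {N : ℕ} → SimpleGraph N → (t : ℕ) → (Fin N → Fin t) → Set
IsPartite G t part = ∀ u v → adj G u v ≡ true → part u ≢ part v

partSize : {N t : ℕ} → (Fin N → Fin t) → Fin t → ℕ
partSize {N} part i = length (filter (λ v → part v ≟F i) (allFin N))

edgesBetween : {N t : ℕ} → SimpleGraph N → (Fin N → Fin t) → Fin t → Fin t → ℕ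
edgesBetween {N} G part i j =
  ΣFin N (λ u → ΣFin N (λ v →
    if ⌊ part u ≟F i ⌋ ∧ ⌊ part v ≟F j ⌋ ∧ adj G u v then 1 else 0))

cycleAdj : (k : ℕ) → Fin k → Fin k → Bool
cycleAdj k a b =
  ⌊ suc (toℕ a) ℕP.≟ toℕ b ⌋ ∨ ⌊ suc (toℕ b) ℕP.≟ toℕ a ⌋ ∨
  (⌊ toℕ a ℕP.≟ 0 ⌋ ∧ ⌊ suc (toℕ b) ℕP.≟ k ⌋) ∨
  (⌊ toℕ b ℕP.≟ 0 ⌋ ∧ ⌊ suc (toℕ a) ℕP.≟ k ⌋)

wheelAdj : (k : ℕ) → Fin (suc k) → Fin (suc k) → Bool
wheelAdj k fzero    fzero    = false
wheelAdj k fzero    (fsuc b) = true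
wheelAdj k (fsuc a) fzero    = true
wheelAdj k (fsuc a) (fsuc b) = cycleAdj k a b

ContainsWheel : {N : ℕ} → SimpleGraph N → ℕ → Set
ContainsWheel {N} G k =
  Σ (Fin (suc k) → Fin N) λ f → Injective _≡_ _≡_ f ×
    (∀ a b → wheelAdj k a b ≡ true → adj G (f a) (f b) ≡ true)

_≤ᵇ'_ : ℕ → ℕ → Bool
m ≤ᵇ' n = ⌊ m ℕP.≤? n ⌋

if1 : Bool → ℕ → ℕ
if1 b x = if b then x else 0

-- Choose q with q·β ≥ 1, so that |V₁| ≥ N/q and t ≤ q. Call a vertex typical if at most
-- N/L vertices outside its own class are non-adjacent to it (L = 30q²). Counting non-edges
-- class pair by class pair, the density condition makes the number of non-adjacent cross pairs
-- at most N²/L², so at most N/L vertices are atypical; in particular V₁ contains a typical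
-- vertex h, the hub. Every class keeps D ≈ N/(3q²) vertices in reserve, which is more than
-- the atypical vertices together with the non-neighbours of three typical vertices. Conditions
-- (i) and (ii) leave enough room outside these reserves to schedule the 2n rim vertices among
-- V₂, …, V_t so that cyclically consecutive ones lie in different classes. The rim is then
-- chosen greedily: each vertex is a typical, unused common neighbour of the hub, of its
-- predecessor and, for the last one, of the first rim vertex.

module Submission where

open import Defs hiding (sym)
open import Data.Nat using (ℕ; zero; suc; pred; _+_; _*_; _∸_; _⊓_; _≤_; _<_; z≤n; s≤s; _≤?_; _<?_; _≟_; NonZero; >-nonZero)
open import Data.Nat.Properties
open import Data.Nat.DivMod using (_/_; _%_; m/n*n≤m; m%n<n; m≡m%n+[m/n]*n)
open import Data.Nat.Coprimality using (1-coprimeTo) renaming (sym to coprime-sym)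
open import Data.Nat.Tactic.RingSolver using (solve-∀)
import Data.Nat.ListAction as List
open import Data.Integer using (+[1+_]; +0; -[1+_])
import Data.Integer as ℤ
import Data.Integer.Properties as ℤ
open import Data.Rational using (ℚ; 0ℚ; 1ℚ) renaming (_+_ to _+ℚ_; _*_ to _*ℚ_; _-_ to _-ℚ_; _≤_ to _≤ℚ_; _<_ to _<ℚ_)
open import Data.Rational using (mkℚ; -_; 1/_; NonNegative; Positive; toℚᵘ; *<*) renaming (_/_ to _/ℚ_)
import Data.Rational.Properties as ℚ
import Data.Rational.Unnormalised as ℚᵘ
import Data.Rational.Unnormalised.Properties as ℚᵘ
open import Data.Bool using (Bool; true; false; _∧_; _∨_; not; if_then_else_)
open import Data.Bool.Properties using (∧-zeroʳ)
open import Data.Fin using (Fin; zero; suc; toℕ; fromℕ<)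
import Data.Fin.Properties as Finₚ
open import Data.List using (length; filter; tabulate; allFin)
open import Data.List.Properties using (map-tabulate)
open import Data.Product using (Σ; ∃; _×_; _,_; proj₁; proj₂)
open import Data.Sum using (_⊎_; inj₁; inj₂)
open import Data.Empty using (⊥; ⊥-elim)
open import Data.Maybe using (nothing)
open import Function using (_∘_; id)
open import Function.Definitions using (Injective)
open import Level using (0ℓ)
open import Relation.Binary using (tri<; tri≈; tri>)
open import Relation.Binary.PropositionalEquality
open import Relation.Nullary.Decidable using (Dec; ⌊_⌋; yes; no)
open import Relation.Unary using (Pred; Decidable)
open import Algebra.Properties.Semiring.Sum +-*-semiring
import Tactic.RingSolver as RingSolver
import Tactic.RingSolver.Core.AlmostCommutativeRing as ACR

-- Finite sums and counting

𝟙 : Bool → ℕ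
𝟙 b = if b then 1 else 0

𝟙-pos : ∀ {b} → 0 < 𝟙 b → b ≡ true
𝟙-pos {true} _ = refl

sum-mono-≤ : ∀ {n} {f g : Fin n → ℕ} → (∀ i → f i ≤ g i) → sum f ≤ sum g
sum-mono-≤ {zero}  f≤g = z≤n
sum-mono-≤ {suc n} f≤g = +-mono-≤ (f≤g zero) (sum-mono-≤ (f≤g ∘ suc))

sum-pos : ∀ {n} (f : Fin n → ℕ) → 0 < sum f → ∃ λ i → 0 < f i
sum-pos {suc n} f pos with f zero in eq
... | suc _ = zero , subst (0 <_) (sym eq) (s≤s z≤n)
... | zero  with sum-pos (f ∘ suc) pos
...   | i , fi>0 = suc i , fi>0

sum-ones : ∀ n → ∑[ i < n ] 1 ≡ n
sum-ones zero    = refl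
sum-ones (suc n) = cong suc (sum-ones n)

sum-δ : ∀ {n} (j : Fin n) (f : Fin n → ℕ) → ∑[ i < n ] (𝟙 ⌊ j Finₚ.≟ i ⌋ * f i) ≡ f j
sum-δ {suc n} zero f = trans (cong₂ _+_ (+-identityʳ (f zero)) (sum-replicate-zero n)) (+-identityʳ (f zero))
sum-δ {suc n} (suc j) f = begin
  ∑[ i < suc n ] (𝟙 ⌊ suc j Finₚ.≟ i ⌋ * f i)  ≡⟨ sum-cong-≗ (λ i → cong (λ b → 𝟙 b * f (suc i)) (≟-suc i)) ⟩
  ∑[ i < n ] (𝟙 ⌊ j Finₚ.≟ i ⌋ * f (suc i))    ≡⟨ sum-δ j (f ∘ suc) ⟩
  f (suc j)                                    ∎
  where
  open ≡-Reasoning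
  ≟-suc : ∀ i → ⌊ suc j Finₚ.≟ suc i ⌋ ≡ ⌊ j Finₚ.≟ i ⌋
  ≟-suc i with j Finₚ.≟ i
  ... | yes _ = refl
  ... | no  _ = refl

count : ∀ {n} → (Fin n → Bool) → ℕ
count {n} P = ∑[ i < n ] 𝟙 (P i)

count-witness : ∀ {n} (P : Fin n → Bool) → 0 < count P → ∃ λ i → P i ≡ true
count-witness P pos with sum-pos (𝟙 ∘ P) pos
... | i , 𝟙Pi>0 = i , 𝟙-pos 𝟙Pi>0

count-split : ∀ {n} (P Q : Fin n → Bool) → count P ≤ count (λ v → P v ∧ Q v) + count (not ∘ Q)
count-split {n} P Q = begin
  count P                                     ≤⟨ sum-mono-≤ {n} (λ v → cover (P v) (Q v)) ⟩
  ∑[ v < n ] (𝟙 (P v ∧ Q v) + 𝟙 (not (Q v)))  ≡⟨ ∑-distrib-+ {n} _ _ ⟩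
  count (λ v → P v ∧ Q v) + count (not ∘ Q)   ∎
  where
  open ≤-Reasoning
  cover : ∀ p q → 𝟙 p ≤ 𝟙 (p ∧ q) + 𝟙 (not q)
  cover true  true  = ≤-refl
  cover true  false = ≤-refl
  cover false q     = z≤n

∧-true : ∀ {a b} → a ∧ b ≡ true → a ≡ true × b ≡ true
∧-true {true} b≡true = refl , b≡true

not-true : ∀ {a} → not a ≡ true → a ≡ false
not-true {false} _ = refl

isYes-true : ∀ {p} {P : Set p} (P? : Dec P) → ⌊ P? ⌋ ≡ true → P
isYes-true (yes p) _ = p

∨-true : ∀ {a b} → a ∨ b ≡ true → a ≡ true ⊎ b ≡ true
∨-true {true}  _      = inj₁ refl
∨-true {false} b≡true = inj₂ b≡true

sumℕ : ℕ → (ℕ → ℕ) → ℕ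
sumℕ zero    f = 0
sumℕ (suc K) f = sumℕ K f + f K

syntax sumℕ K (λ k → e) = ∑ℕ[ k < K ] e

sumℕ-cong : ∀ K {f g : ℕ → ℕ} → (∀ k → k < K → f k ≡ g k) → sumℕ K f ≡ sumℕ K g
sumℕ-cong zero    f≡g = refl
sumℕ-cong (suc K) f≡g = cong₂ _+_ (sumℕ-cong K (λ k k<K → f≡g k (m<n⇒m<1+n k<K))) (f≡g K ≤-refl)

sumℕ-mono-≤ : ∀ K {f g : ℕ → ℕ} → (∀ k → k < K → f k ≤ g k) → sumℕ K f ≤ sumℕ K g
sumℕ-mono-≤ zero    f≤g = z≤n
sumℕ-mono-≤ (suc K) f≤g = +-mono-≤ (sumℕ-mono-≤ K (λ k k<K → f≤g k (m<n⇒m<1+n k<K))) (f≤g K ≤-refl)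

sumℕ-monoˡ-≤ : ∀ (f : ℕ → ℕ) {K L} → K ≤ L → sumℕ K f ≤ sumℕ L f
sumℕ-monoˡ-≤ f {K} {zero}  z≤n = z≤n
sumℕ-monoˡ-≤ f {K} {suc L} K≤1+L with m≤n⇒m<n∨m≡n K≤1+L
... | inj₁ K<1+L = ≤-trans (sumℕ-monoˡ-≤ f (≤-pred K<1+L)) (m≤m+n (sumℕ L f) (f L))
... | inj₂ refl  = ≤-refl

sumℕ-suc : ∀ K (f : ℕ → ℕ) → sumℕ (suc K) f ≡ f 0 + sumℕ K (f ∘ suc)
sumℕ-suc zero    f = +-comm 0 (f 0)
sumℕ-suc (suc K) f = trans (cong (_+ f (suc K)) (sumℕ-suc K f)) (+-assoc (f 0) _ _)

sumℕ-+ : ∀ K L (f : ℕ → ℕ) → sumℕ (K + L) f ≡ sumℕ K f + sumℕ L (f ∘ (K +_))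
sumℕ-+ K zero    f = trans (cong (λ z → sumℕ z f) (+-identityʳ K)) (sym (+-identityʳ _))
sumℕ-+ K (suc L) f = begin
  sumℕ (K + suc L) f                          ≡⟨ cong (λ z → sumℕ z f) (+-suc K L) ⟩
  sumℕ (K + L) f + f (K + L)                  ≡⟨ cong (_+ f (K + L)) (sumℕ-+ K L f) ⟩
  sumℕ K f + sumℕ L (f ∘ (K +_)) + f (K + L)  ≡⟨ +-assoc (sumℕ K f) _ _ ⟩
  sumℕ K f + sumℕ (suc L) (f ∘ (K +_))        ∎
  where open ≡-Reasoning

sum-toℕ : ∀ K (f : ℕ → ℕ) → ∑[ i < K ] f (toℕ i) ≡ sumℕ K f
sum-toℕ zero    f = refl
sum-toℕ (suc K) f = trans (cong (f 0 +_) (sum-toℕ K (f ∘ suc))) (sym (sumℕ-suc K f))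

sumℕ-∸ : ∀ K (f : ℕ → ℕ) d → (∀ k → k < K → d ≤ f k) → ∑ℕ[ k < K ] (f k ∸ d) + K * d ≡ ∑ℕ[ k < K ] f k
sumℕ-∸ zero    f d d≤f = refl
sumℕ-∸ (suc K) f d d≤f = begin
  ∑ℕ[ k < K ] (f k ∸ d) + (f K ∸ d) + (d + K * d)   ≡⟨ regroup (∑ℕ[ k < K ] (f k ∸ d)) (f K ∸ d) d (K * d) ⟩
  (∑ℕ[ k < K ] (f k ∸ d) + K * d) + (f K ∸ d + d)   ≡⟨ cong₂ _+_ (sumℕ-∸ K f d (λ k k<K → d≤f k (m<n⇒m<1+n k<K)))
                                                                 (m∸n+n≡m (d≤f K ≤-refl)) ⟩
  ∑ℕ[ k < K ] f k + f K                             ∎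
  where
  open ≡-Reasoning
  regroup : ∀ a b c e → a + b + (c + e) ≡ (a + e) + (b + c)
  regroup = solve-∀

count-interval : ∀ K a b → ∑ℕ[ k < K ] 𝟙 (⌊ a ≤? k ⌋ ∧ ⌊ k <? b ⌋) ≤ b ∸ a
count-interval K a b = ≤-trans (bounded K) (∸-monoˡ-≤ a (m⊓n≤n K b))
  where
  open ≤-Reasoning
  bounded : ∀ K → ∑ℕ[ k < K ] 𝟙 (⌊ a ≤? k ⌋ ∧ ⌊ k <? b ⌋) ≤ (K ⊓ b) ∸ a
  unchanged : ∀ K → ∑ℕ[ k < K ] 𝟙 (⌊ a ≤? k ⌋ ∧ ⌊ k <? b ⌋) + 0 ≤ (suc K ⊓ b) ∸ a
  bounded zero = z≤n
  bounded (suc K) with a ≤? K | K <? b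
  ... | yes a≤K | yes K<b = begin
    ∑ℕ[ k < K ] 𝟙 (⌊ a ≤? k ⌋ ∧ ⌊ k <? b ⌋) + 1  ≤⟨ +-monoˡ-≤ 1 (bounded K) ⟩
    (K ⊓ b) ∸ a + 1                              ≡⟨ cong (λ z → z ∸ a + 1) (m≤n⇒m⊓n≡m (<⇒≤ K<b)) ⟩
    K ∸ a + 1                                    ≡⟨ +-comm (K ∸ a) 1 ⟩
    suc (K ∸ a)                                  ≡⟨ +-∸-assoc 1 a≤K ⟨
    suc K ∸ a                                    ≡⟨ cong (_∸ a) (m≤n⇒m⊓n≡m K<b) ⟨
    (suc K ⊓ b) ∸ a                              ∎
  ... | no _    | _       = unchanged K
  ... | yes _   | no _    = unchanged K
  unchanged K = ≤-trans (≤-reflexive (+-identityʳ _)) (≤-trans (bounded K) (∸-monoˡ-≤ a (⊓-monoˡ-≤ b (n≤1+n K))))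

-- Cyclic schedules

parity : ∀ k → ∃ λ j → k ≡ j + j ⊎ k ≡ suc (j + j)
parity zero = 0 , inj₁ refl
parity (suc k) with parity k
... | j , inj₁ refl = j , inj₂ refl
... | j , inj₂ refl = suc j , inj₁ (cong suc (sym (+-suc j j)))

interleave : (ℕ → ℕ) → (ℕ → ℕ) → ℕ → ℕ
interleave f g zero          = f 0
interleave f g (suc zero)    = g 0
interleave f g (suc (suc k)) = interleave (f ∘ suc) (g ∘ suc) k

interleave-even : ∀ j f g → interleave f g (j + j) ≡ f j
interleave-even zero    f g = refl
interleave-even (suc j) f g rewrite +-suc j j = interleave-even j (f ∘ suc) (g ∘ suc)

interleave-odd : ∀ j f g → interleave f g (suc (j + j)) ≡ g j
interleave-odd zero    f g = refl
interleave-odd (suc j) f g rewrite +-suc j j = interleave-odd j (f ∘ suc) (g ∘ suc)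

sumℕ-interleave : ∀ j (h f g : ℕ → ℕ) →
  ∑ℕ[ k < j + j ] h (interleave f g k) ≡ ∑ℕ[ i < j ] h (f i) + ∑ℕ[ i < j ] h (g i)
sumℕ-interleave zero    h f g = refl
sumℕ-interleave (suc j) h f g
  rewrite +-suc j j | interleave-even j f g | interleave-odd j f g | sumℕ-interleave j h f g =
  shuffle (∑ℕ[ i < j ] h (f i)) (∑ℕ[ i < j ] h (g i)) (h (f j)) (h (g j))
  where
  shuffle : ∀ a b c d → a + b + c + d ≡ a + c + (b + d)
  shuffle = solve-∀

record CyclicSchedule (len m : ℕ) (c : ℕ → ℕ) : Set where
  field
    colour         : ℕ → ℕ
    colour≤        : ∀ k → colour k ≤ m
    proper         : ∀ k → suc k < len → colour k ≢ colour (suc k)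
    closing        : ∀ k → suc k ≡ len → colour k ≢ colour 0
    withinCapacity : ∀ r → ∑ℕ[ k < len ] 𝟙 ⌊ colour k ≟ r ⌋ ≤ c r

-- The slots 0, …, 2n − 1 are dealt out block by block, colour r receiving the next `capped r`
-- slots; the schedule then reads slot 0, slot n, slot 1, slot n + 1, and so on.
module CyclicScheduleConstruction (n m : ℕ) (c : ℕ → ℕ) (1≤n : 1 ≤ n)
  (c≤c₀ : ∀ r → r < m → c (suc r) ≤ c 0)
  (enough : n + n ≤ c 0 ⊓ n + ∑ℕ[ r < m ] c (suc r)) where

  capped : ℕ → ℕ
  capped zero    = c 0 ⊓ n
  capped (suc r) = c (suc r)

  blockStart : ℕ → ℕ
  blockStart r = ∑ℕ[ s < r ] capped s

  2n≤total : n + n ≤ blockStart (suc m)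
  2n≤total = subst (n + n ≤_) (sym (sumℕ-suc m capped)) enough

  search : ℕ → ℕ → ℕ → ℕ
  search k r zero    = r
  search k r (suc f) = if ⌊ k <? blockStart (suc r) ⌋ then r else search k (suc r) f

  search≤ : ∀ k r f → search k r f ≤ r + f
  search≤ k r zero    = ≤-reflexive (sym (+-identityʳ r))
  search≤ k r (suc f) with k <? blockStart (suc r)
  ... | yes _ = m≤m+n r (suc f)
  ... | no  _ = ≤-trans (search≤ k (suc r) f) (≤-reflexive (sym (+-suc r f)))

  search-spec : ∀ k r f → r + f ≡ m → blockStart r ≤ k → k < blockStart (suc m) →
    blockStart (search k r f) ≤ k × k < blockStart (suc (search k r f))
  search-spec k r zero    r+0≡m r≤k k<total rewrite +-identityʳ r | r+0≡m = r≤k , k<total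
  search-spec k r (suc f) r+f≡m r≤k k<total with k <? blockStart (suc r)
  ... | yes k<next = r≤k , k<next
  ... | no  k≮next = search-spec k (suc r) f (trans (sym (+-suc r f)) r+f≡m) (≮⇒≥ k≮next) k<total

  block : ℕ → ℕ
  block k = search k 0 m

  block≤m : ∀ k → block k ≤ m
  block≤m k = search≤ k 0 m

  block-spec : ∀ k → k < blockStart (suc m) → blockStart (block k) ≤ k × k < blockStart (block k) + capped (block k)
  block-spec k = search-spec k 0 m refl z≤n

  long-blocks-start-late : ∀ r → suc r ≤ m → n ≤ capped (suc r) → n ≤ blockStart (suc r)
  long-blocks-start-late r 1+r≤m long = begin
    n                   ≡⟨ m≥n⇒m⊓n≡n (≤-trans long (c≤c₀ r 1+r≤m)) ⟨
    blockStart 1        ≤⟨ sumℕ-monoˡ-≤ capped {1} {suc r} (s≤s z≤n) ⟩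
    blockStart (suc r)  ∎
    where open ≤-Reasoning

  -- Block 0 comes first and has at most n slots, and every block is at most as long as block 0
  -- before capping; so a block with n or more slots starts at slot n or later.
  apart : ∀ {i k} → i < n → n ≤ k → i + n ≤ suc k → k < blockStart (suc m) → block i ≢ block k
  apart {i} {k} i<n n≤k i+n≤1+k k<total same = in-block-of-k (block k) (block≤m k) blockStart≤i k<end
    where
    blockStart≤i : blockStart (block k) ≤ i
    blockStart≤i = subst (λ r → blockStart r ≤ i) same
                (proj₁ (block-spec i (<-≤-trans i<n (≤-trans n≤k (<⇒≤ k<total)))))
    k<end : k < blockStart (block k) + capped (block k)
    k<end = proj₂ (block-spec k k<total)
    in-block-of-k : ∀ r → r ≤ m → blockStart r ≤ i → k < blockStart r + capped r → ⊥
    in-block-of-k zero    _      _   k<c₀  = <⇒≱ (≤-trans k<c₀ (m⊓n≤n (c 0) n)) n≤k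
    in-block-of-k (suc r) 1+r≤m s≤i k<end with n ≤? capped (suc r)
    ... | yes long  = <⇒≱ i<n (≤-trans (long-blocks-start-late r 1+r≤m long) s≤i)
    ... | no  short = <⇒≱ (≤-<-trans (≤-trans k<end (+-monoˡ-≤ _ s≤i)) (+-monoʳ-< i (≰⇒> short))) i+n≤1+k

  colour : ℕ → ℕ
  colour = interleave block (block ∘ (n +_))

  colour≤ : ∀ k → colour k ≤ m
  colour≤ k with parity k
  ... | j , inj₁ refl rewrite interleave-even j block (block ∘ (n +_)) = block≤m j
  ... | j , inj₂ refl rewrite interleave-odd  j block (block ∘ (n +_)) = block≤m (n + j)

  half-< : ∀ {j} → j + j < n + n → j < n
  half-< j+j<2n = ≰⇒> (λ n≤j → ≤⇒≯ (+-mono-≤ n≤j n≤j) j+j<2n)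

  second-half-in-range : ∀ {j} → j < n → n + j < blockStart (suc m)
  second-half-in-range j<n = <-≤-trans (+-monoʳ-< n j<n) 2n≤total

  proper : ∀ k → suc k < n + n → colour k ≢ colour (suc k)
  proper k 1+k<2n with parity k
  ... | j , inj₁ refl
    rewrite interleave-even j block (block ∘ (n +_)) | interleave-odd j block (block ∘ (n +_)) =
    apart j<n (m≤m+n n j) (≤-trans (≤-reflexive (+-comm j n)) (n≤1+n (n + j))) (second-half-in-range j<n)
    where
    j<n : j < n
    j<n = half-< (<-trans (n<1+n (j + j)) 1+k<2n)
  ... | j , inj₂ refl
    rewrite interleave-odd j block (block ∘ (n +_)) | interleave-even j (block ∘ suc) (block ∘ (n +_) ∘ suc) =
    λ same → apart 1+j<n (m≤m+n n j) (≤-reflexive (cong suc (+-comm j n))) (second-half-in-range j<n) (sym same)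
    where
    1+j<n : suc j < n
    1+j<n = half-< (subst (_< n + n) (cong suc (sym (+-suc j j))) 1+k<2n)
    j<n : j < n
    j<n = <-trans (n<1+n j) 1+j<n

  closing : ∀ k → suc k ≡ n + n → colour k ≢ colour 0
  closing k 1+k≡2n same = apart 1≤n (m≤m+n n j) (≤-trans (m≤m+n n j) (n≤1+n _)) (second-half-in-range j<n)
                            (sym (trans (sym last≡) same))
    where
    j : ℕ
    j = n ∸ 1
    n≡1+j : n ≡ suc j
    n≡1+j = sym (trans (+-comm 1 j) (m∸n+n≡m 1≤n))
    j<n : j < n
    j<n = ≤-reflexive (sym n≡1+j)
    last≡ : colour k ≡ block (n + j)
    last≡ = trans (cong colour (suc-injective (trans 1+k≡2n (trans (cong₂ _+_ n≡1+j n≡1+j) (cong suc (+-suc j j))))))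
                  (interleave-odd j block (block ∘ (n +_)))

  capped≤c : ∀ r → capped r ≤ c r
  capped≤c zero    = m⊓n≤m (c 0) n
  capped≤c (suc r) = ≤-refl

  within-block : ∀ r i → i < n + n → 𝟙 ⌊ block i ≟ r ⌋ ≤ 𝟙 (⌊ blockStart r ≤? i ⌋ ∧ ⌊ i <? blockStart (suc r) ⌋)
  within-block r i i<2n with block i ≟ r
  ... | no  _    = z≤n
  ... | yes refl with block-spec i (<-≤-trans i<2n 2n≤total)
  ...   | s≤i , i<e with blockStart (block i) ≤? i | i <? blockStart (suc (block i))
  ...     | yes _   | yes _   = ≤-refl
  ...     | no  s≰i | _       = ⊥-elim (s≰i s≤i)
  ...     | yes _   | no  i≮e = ⊥-elim (i≮e i<e)

  withinCapacity : ∀ r → ∑ℕ[ k < n + n ] 𝟙 ⌊ colour k ≟ r ⌋ ≤ c r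
  withinCapacity r = begin
    ∑ℕ[ k < n + n ] 𝟙 ⌊ colour k ≟ r ⌋
      ≡⟨ sumℕ-interleave n (λ b → 𝟙 ⌊ b ≟ r ⌋) block (block ∘ (n +_)) ⟩
    ∑ℕ[ i < n ] 𝟙 ⌊ block i ≟ r ⌋ + ∑ℕ[ i < n ] 𝟙 ⌊ block (n + i) ≟ r ⌋
      ≡⟨ sumℕ-+ n n (λ i → 𝟙 ⌊ block i ≟ r ⌋) ⟨
    ∑ℕ[ i < n + n ] 𝟙 ⌊ block i ≟ r ⌋
      ≤⟨ sumℕ-mono-≤ (n + n) (within-block r) ⟩
    ∑ℕ[ i < n + n ] 𝟙 (⌊ blockStart r ≤? i ⌋ ∧ ⌊ i <? blockStart (suc r) ⌋)
      ≤⟨ count-interval (n + n) (blockStart r) (blockStart (suc r)) ⟩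
    blockStart (suc r) ∸ blockStart r
      ≡⟨ m+n∸m≡n (blockStart r) (capped r) ⟩
    capped r
      ≤⟨ capped≤c r ⟩
    c r ∎
    where open ≤-Reasoning

cyclicSchedule : ∀ n m (c : ℕ → ℕ) → 1 ≤ n → (∀ r → r < m → c (suc r) ≤ c 0) →
  n + n ≤ c 0 ⊓ n + ∑ℕ[ r < m ] c (suc r) → CyclicSchedule (n + n) m c
cyclicSchedule n m c 1≤n c≤c₀ enough = record
  { colour = colour ; colour≤ = colour≤ ; proper = proper ; closing = closing ; withinCapacity = withinCapacity }
  where open CyclicScheduleConstruction n m c 1≤n c≤c₀ enough

-- Colour classes, non-edges and typical vertices

ΣFin≡sum : ∀ n (f : Fin n → ℕ) → ΣFin n f ≡ ∑[ i < n ] f i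
ΣFin≡sum n f = trans (cong List.sum (map-tabulate id f)) (sum-tabulate n f)
  where
  sum-tabulate : ∀ n (g : Fin n → ℕ) → List.sum (tabulate g) ≡ ∑[ i < n ] g i
  sum-tabulate zero    g = refl
  sum-tabulate (suc n) g = cong (g zero +_) (sum-tabulate n (g ∘ suc))

length-filter≡count : ∀ n {p} {P : Pred (Fin n) p} (P? : Decidable P) → length (filter P? (allFin n)) ≡ count (λ i → ⌊ P? i ⌋)
length-filter≡count n P? = go n id
  where
  go : ∀ k (g : Fin k → Fin n) → length (filter P? (tabulate g)) ≡ ∑[ i < k ] 𝟙 ⌊ P? (g i) ⌋
  go zero    g = refl
  go (suc k) g with P? (g zero)
  ... | yes _ = cong suc (go k (g ∘ suc))
  ... | no  _ = go k (g ∘ suc)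

toℕ-≟ : ∀ {n} (a b : Fin n) → ⌊ toℕ a ≟ toℕ b ⌋ ≡ ⌊ a Finₚ.≟ b ⌋
toℕ-≟ a b with toℕ a ≟ toℕ b | a Finₚ.≟ b
... | yes _   | yes _ = refl
... | no  _   | no  _ = refl
... | yes a≡b | no a≢b  = ⊥-elim (a≢b (Finₚ.toℕ-injective a≡b))
... | no a≢b  | yes refl = ⊥-elim (a≢b refl)

module Classes {N t : ℕ} (G : SimpleGraph N) (part : Fin N → Fin t) where

  class : Fin N → ℕ
  class v = toℕ (part v)

  inClass : ℕ → Fin N → Bool
  inClass p v = ⌊ class v ≟ p ⌋

  classSize : ℕ → ℕ
  classSize p = count (inClass p)

  partSize≡classSize : ∀ i → partSize part i ≡ classSize (toℕ i)
  partSize≡classSize i = trans (length-filter≡count N (λ v → part v Finₚ.≟ i))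
                               (sum-cong-≗ {N} (λ v → cong 𝟙 (sym (toℕ-≟ (part v) i))))

  in-exactly-one-class : ∀ u → ∑[ i < t ] 𝟙 (inClass (toℕ i) u) ≡ 1
  in-exactly-one-class u = begin
    ∑[ i < t ] 𝟙 (inClass (toℕ i) u)
      ≡⟨ sum-cong-≗ {t} (λ i → trans (cong 𝟙 (toℕ-≟ (part u) i)) (sym (*-identityʳ _))) ⟩
    ∑[ i < t ] (𝟙 ⌊ part u Finₚ.≟ i ⌋ * 1)
      ≡⟨ sum-δ (part u) (λ _ → 1) ⟩
    1 ∎
    where open ≡-Reasoning

  sum-by-class : ∀ (g : Fin N → ℕ) → ∑[ u < N ] g u ≡ ∑[ i < t ] ∑[ u < N ] (𝟙 (inClass (toℕ i) u) * g u)
  sum-by-class g = begin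
    ∑[ u < N ] g u
      ≡⟨ sum-cong-≗ {N} (λ u → sym (trans (cong (_* g u) (in-exactly-one-class u)) (*-identityˡ (g u)))) ⟩
    ∑[ u < N ] (∑[ i < t ] 𝟙 (inClass (toℕ i) u) * g u)
      ≡⟨ sum-cong-≗ {N} (λ u → *-distribʳ-sum {t} (g u) (λ i → 𝟙 (inClass (toℕ i) u))) ⟩
    ∑[ u < N ] ∑[ i < t ] (𝟙 (inClass (toℕ i) u) * g u)
      ≡⟨ ∑-comm {N} {t} (λ u i → 𝟙 (inClass (toℕ i) u) * g u) ⟩
    ∑[ i < t ] ∑[ u < N ] (𝟙 (inClass (toℕ i) u) * g u) ∎
    where open ≡-Reasoning

  sum-classSize : ∑[ i < t ] classSize (toℕ i) ≡ N
  sum-classSize = begin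
    ∑[ i < t ] classSize (toℕ i)                       ≡⟨ sum-cong-≗ {t} (λ i → sum-cong-≗ {N} (λ u → sym (*-identityʳ _))) ⟩
    ∑[ i < t ] ∑[ u < N ] (𝟙 (inClass (toℕ i) u) * 1)  ≡⟨ sum-by-class (λ _ → 1) ⟨
    ∑[ u < N ] 1                                       ≡⟨ sum-ones N ⟩
    N                                                  ∎
    where open ≡-Reasoning

  edges nonEdges : ℕ → ℕ → ℕ
  edges    p q = ∑[ u < N ] ∑[ v < N ] 𝟙 (inClass p u ∧ inClass q v ∧ adj G u v)
  nonEdges p q = ∑[ u < N ] ∑[ v < N ] 𝟙 (inClass p u ∧ inClass q v ∧ not (adj G u v))

  edgesBetween≡edges : ∀ i j → edgesBetween G part i j ≡ edges (toℕ i) (toℕ j)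
  edgesBetween≡edges i j = trans (ΣFin≡sum N _) (sum-cong-≗ {N} λ u → trans (ΣFin≡sum N _) (sum-cong-≗ {N} λ v →
    cong₂ (λ a b → 𝟙 (a ∧ b ∧ adj G u v)) (sym (toℕ-≟ (part u) i)) (sym (toℕ-≟ (part v) j))))

  classSize-* : ∀ p q → classSize p * classSize q ≡ edges p q + nonEdges p q
  classSize-* p q = begin
    classSize p * classSize q
      ≡⟨ *-distribʳ-sum {N} (classSize q) (λ u → 𝟙 (inClass p u)) ⟩
    ∑[ u < N ] (𝟙 (inClass p u) * classSize q)
      ≡⟨ sum-cong-≗ {N} (λ u → *-distribˡ-sum {N} (𝟙 (inClass p u)) (λ v → 𝟙 (inClass q v))) ⟩
    ∑[ u < N ] ∑[ v < N ] (𝟙 (inClass p u) * 𝟙 (inClass q v))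
      ≡⟨ sum-cong-≗ {N} (λ u → sum-cong-≗ {N} (λ v → split (inClass p u) (inClass q v) (adj G u v))) ⟩
    ∑[ u < N ] ∑[ v < N ] (𝟙 (inClass p u ∧ inClass q v ∧ adj G u v) + 𝟙 (inClass p u ∧ inClass q v ∧ not (adj G u v)))
      ≡⟨ sum-cong-≗ {N} (λ u → ∑-distrib-+ {N} _ _) ⟩
    ∑[ u < N ] (∑[ v < N ] 𝟙 (inClass p u ∧ inClass q v ∧ adj G u v) + ∑[ v < N ] 𝟙 (inClass p u ∧ inClass q v ∧ not (adj G u v)))
      ≡⟨ ∑-distrib-+ {N} _ _ ⟩
    edges p q + nonEdges p q ∎
    where
    open ≡-Reasoning
    split : ∀ a b e → 𝟙 a * 𝟙 b ≡ 𝟙 (a ∧ b ∧ e) + 𝟙 (a ∧ b ∧ not e)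
    split true  true  true  = refl
    split true  true  false = refl
    split true  false e     = refl
    split false b     e     = refl

  nonEdges-sym : ∀ p q → nonEdges p q ≡ nonEdges q p
  nonEdges-sym p q = trans (∑-comm {N} {N} _) (sum-cong-≗ {N} λ v → sum-cong-≗ {N} λ u →
    cong 𝟙 (trans (swap (inClass p u) (inClass q v) _) (cong (λ e → inClass q v ∧ inClass p u ∧ not e) (SimpleGraph.sym G u v))))
    where
    swap : ∀ a b e → (a ∧ b ∧ e) ≡ (b ∧ a ∧ e)
    swap true  true  e = refl
    swap true  false e = refl
    swap false true  e = refl
    swap false false e = refl

  crossNonAdjacent : Fin N → Fin N → ℕ
  crossNonAdjacent u v = 𝟙 (not ⌊ class u ≟ class v ⌋ ∧ not (adj G u v))

  antiDegree : Fin N → ℕ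
  antiDegree u = ∑[ v < N ] crossNonAdjacent u v

  crossNonEdges : ℕ → ℕ → ℕ
  crossNonEdges p q = ∑[ u < N ] ∑[ v < N ] (𝟙 (inClass q v) * (𝟙 (inClass p u) * crossNonAdjacent u v))

  sum-antiDegree : ∑[ u < N ] antiDegree u ≡ ∑[ i < t ] ∑[ j < t ] crossNonEdges (toℕ i) (toℕ j)
  sum-antiDegree = begin
    ∑[ u < N ] antiDegree u
      ≡⟨ sum-by-class antiDegree ⟩
    ∑[ i < t ] ∑[ u < N ] (𝟙 (inClass (toℕ i) u) * antiDegree u)
      ≡⟨ sum-cong-≗ {t} (λ i → sum-cong-≗ {N} (λ u → split-by-class (toℕ i) u)) ⟩
    ∑[ i < t ] ∑[ u < N ] ∑[ j < t ] ∑[ v < N ] (𝟙 (inClass (toℕ j) v) * (𝟙 (inClass (toℕ i) u) * crossNonAdjacent u v))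
      ≡⟨ sum-cong-≗ {t} (λ i → ∑-comm {N} {t} _) ⟩
    ∑[ i < t ] ∑[ j < t ] crossNonEdges (toℕ i) (toℕ j) ∎
    where
    open ≡-Reasoning
    split-by-class : ∀ p u → 𝟙 (inClass p u) * antiDegree u ≡
      ∑[ j < t ] ∑[ v < N ] (𝟙 (inClass (toℕ j) v) * (𝟙 (inClass p u) * crossNonAdjacent u v))
    split-by-class p u = trans (*-distribˡ-sum {N} (𝟙 (inClass p u)) (crossNonAdjacent u))
                               (sum-by-class (λ v → 𝟙 (inClass p u) * crossNonAdjacent u v))

  crossNonEdges≤nonEdges : ∀ p q → crossNonEdges p q ≤ nonEdges p q
  crossNonEdges≤nonEdges p q = sum-mono-≤ λ u → sum-mono-≤ λ v → drop-apart (inClass p u) (inClass q v) _ _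
    where
    drop-apart : ∀ a b x e → 𝟙 b * (𝟙 a * 𝟙 (x ∧ e)) ≤ 𝟙 (a ∧ b ∧ e)
    drop-apart true  true  true  e = ≤-reflexive (trans (+-identityʳ _) (+-identityʳ _))
    drop-apart true  true  false e = z≤n
    drop-apart true  false x     e = z≤n
    drop-apart false true  x     e = z≤n
    drop-apart false false x     e = z≤n

  crossNonEdges-diag : ∀ p → crossNonEdges p p ≡ 0
  crossNonEdges-diag p = trans (sum-cong-≗ {N} λ u → trans (sum-cong-≗ {N} (no-crossing u)) (sum-replicate-zero N))
                               (sum-replicate-zero N)
    where
    no-crossing : ∀ u v → 𝟙 (inClass p v) * (𝟙 (inClass p u) * crossNonAdjacent u v) ≡ 0
    no-crossing u v with class v ≟ p | class u ≟ p | class u ≟ class v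
    ... | yes _   | yes _   | yes _  = refl
    ... | yes v∈p | yes u∈p | no u≢v = ⊥-elim (u≢v (trans u∈p (sym v∈p)))
    ... | yes _   | no _    | _      = refl
    ... | no _    | _       | _      = refl

  antiDegree-sum-bound : ∀ M → (∀ (i j : Fin t) → toℕ i < toℕ j → M * nonEdges (toℕ i) (toℕ j) ≤ classSize (toℕ i) * classSize (toℕ j)) →
    M * ∑[ u < N ] antiDegree u ≤ N * N
  antiDegree-sum-bound M sparse = begin
    M * ∑[ u < N ] antiDegree u                                ≡⟨ cong (M *_) sum-antiDegree ⟩
    M * ∑[ i < t ] ∑[ j < t ] crossNonEdges (toℕ i) (toℕ j)    ≡⟨ *-distribˡ-sum {t} M _ ⟩
    ∑[ i < t ] (M * ∑[ j < t ] crossNonEdges (toℕ i) (toℕ j))  ≡⟨ sum-cong-≗ {t} (λ i → *-distribˡ-sum {t} M _) ⟩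
    ∑[ i < t ] ∑[ j < t ] (M * crossNonEdges (toℕ i) (toℕ j))  ≤⟨ sum-mono-≤ {t} (λ i → sum-mono-≤ {t} (pair i)) ⟩
    ∑[ i < t ] ∑[ j < t ] (classSize (toℕ i) * classSize (toℕ j))
      ≡⟨ sum-cong-≗ {t} (λ i → *-distribˡ-sum {t} (classSize (toℕ i)) _) ⟨
    ∑[ i < t ] (classSize (toℕ i) * ∑[ j < t ] classSize (toℕ j))
      ≡⟨ *-distribʳ-sum {t} (∑[ j < t ] classSize (toℕ j)) (classSize ∘ toℕ) ⟨
    ∑[ i < t ] classSize (toℕ i) * ∑[ j < t ] classSize (toℕ j)  ≡⟨ cong₂ _*_ sum-classSize sum-classSize ⟩
    N * N                                                        ∎
    where
    open ≤-Reasoning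
    pair : ∀ i j → M * crossNonEdges (toℕ i) (toℕ j) ≤ classSize (toℕ i) * classSize (toℕ j)
    pair i j with <-cmp (toℕ i) (toℕ j)
    ... | tri< i<j _ _ = ≤-trans (*-monoʳ-≤ M (crossNonEdges≤nonEdges _ _)) (sparse i j i<j)
    ... | tri≈ _ i≡j _ rewrite i≡j | crossNonEdges-diag (toℕ j) | *-zeroʳ M = z≤n
    ... | tri> _ _ j<i = begin
      M * crossNonEdges (toℕ i) (toℕ j)      ≤⟨ *-monoʳ-≤ M (crossNonEdges≤nonEdges _ _) ⟩
      M * nonEdges (toℕ i) (toℕ j)           ≡⟨ cong (M *_) (nonEdges-sym _ _) ⟩
      M * nonEdges (toℕ j) (toℕ i)           ≤⟨ sparse j i j<i ⟩
      classSize (toℕ j) * classSize (toℕ i)  ≡⟨ *-comm (classSize (toℕ j)) (classSize (toℕ i)) ⟩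
      classSize (toℕ i) * classSize (toℕ j)  ∎

  module Typical (L : ℕ) where

    typical : Fin N → Bool
    typical v = ⌊ L * antiDegree v ≤? N ⌋

    typical-antiDegree : ∀ {v} → typical v ≡ true → L * antiDegree v ≤ N
    typical-antiDegree {v} eq with L * antiDegree v ≤? N
    ... | yes bounded = bounded

    atypicalCount : ℕ
    atypicalCount = count (not ∘ typical)

    atypicalCount-bound : 0 < N → L * L * ∑[ u < N ] antiDegree u ≤ N * N → L * atypicalCount ≤ N
    atypicalCount-bound 0<N few-nonAdjacent = *-cancelʳ-≤ (L * atypicalCount) N N {{>-nonZero 0<N}} (begin
      L * atypicalCount * N              ≡⟨ *-assoc L atypicalCount N ⟩
      L * (atypicalCount * N)            ≤⟨ *-monoʳ-≤ L markov ⟩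
      L * (L * ∑[ u < N ] antiDegree u)  ≡⟨ *-assoc L L _ ⟨
      L * L * ∑[ u < N ] antiDegree u    ≤⟨ few-nonAdjacent ⟩
      N * N                              ∎)
      where
      open ≤-Reasoning
      atypical-pointwise : ∀ v → 𝟙 (not (typical v)) * N ≤ L * antiDegree v
      atypical-pointwise v with L * antiDegree v ≤? N
      ... | yes _    = z≤n
      ... | no  many = ≤-trans (≤-reflexive (+-identityʳ N)) (<⇒≤ (≰⇒> many))
      markov : atypicalCount * N ≤ L * ∑[ u < N ] antiDegree u
      markov = begin
        atypicalCount * N                     ≡⟨ *-distribʳ-sum {N} N (𝟙 ∘ not ∘ typical) ⟩
        ∑[ v < N ] (𝟙 (not (typical v)) * N)  ≤⟨ sum-mono-≤ {N} atypical-pointwise ⟩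
        ∑[ v < N ] (L * antiDegree v)         ≡⟨ *-distribˡ-sum {N} L antiDegree ⟨
        L * ∑[ u < N ] antiDegree u           ∎

    candidate : ℕ → (Fin N → Bool) → Fin N → Fin N → Fin N → Fin N → Bool
    candidate p used h a b v = inClass p v ∧ typical v ∧ not (used v) ∧ adj G h v ∧ adj G a v ∧ adj G b v

    module _ (p : ℕ) (used : Fin N → Bool) {h a b : Fin N} (h∉p : class h ≢ p) (a∉p : class a ≢ p) (b∉p : class b ≢ p) where

      excluded-or-candidate : ∀ v → 𝟙 (inClass p v) ≤
        𝟙 (not (typical v)) + 𝟙 (inClass p v ∧ used v) + crossNonAdjacent h v + crossNonAdjacent a v + crossNonAdjacent b v
        + 𝟙 (candidate p used h a b v)
      excluded-or-candidate v with class v ≟ p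
      ... | no _ = z≤n
      ... | yes refl with class h ≟ class v | class a ≟ class v | class b ≟ class v
      ...   | yes h∈p | _       | _       = ⊥-elim (h∉p h∈p)
      ...   | no _    | yes a∈p | _       = ⊥-elim (a∉p a∈p)
      ...   | no _    | no _    | yes b∈p = ⊥-elim (b∉p b∈p)
      ...   | no _    | no _    | no _    = exhaust (typical v) (used v) (adj G h v) (adj G a v) (adj G b v)
        where
        exhaust : ∀ g u x y z → 1 ≤ 𝟙 (not g) + 𝟙 u + 𝟙 (not x) + 𝟙 (not y) + 𝟙 (not z) + 𝟙 (g ∧ not u ∧ x ∧ y ∧ z)
        exhaust false _     _     _     _     = s≤s z≤n
        exhaust true  true  _     _     _     = s≤s z≤n
        exhaust true  false false _     _     = s≤s z≤n
        exhaust true  false true  false _     = s≤s z≤n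
        exhaust true  false true  true  false = s≤s z≤n
        exhaust true  false true  true  true  = s≤s z≤n

      classSize≤excluded+candidates : classSize p ≤
        atypicalCount + count (λ v → inClass p v ∧ used v) + antiDegree h + antiDegree a + antiDegree b
        + count (candidate p used h a b)
      classSize≤excluded+candidates = begin
        classSize p
          ≤⟨ sum-mono-≤ {N} excluded-or-candidate ⟩
        ∑[ v < N ] (𝟙 (not (typical v)) + 𝟙 (inClass p v ∧ used v) + crossNonAdjacent h v + crossNonAdjacent a v
                    + crossNonAdjacent b v + 𝟙 (candidate p used h a b v))
          ≡⟨ ∑-distrib-+ {N} _ _ ⟩
        ∑[ v < N ] (𝟙 (not (typical v)) + 𝟙 (inClass p v ∧ used v) + crossNonAdjacent h v + crossNonAdjacent a v
                    + crossNonAdjacent b v) + C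
          ≡⟨ cong (_+ C) (∑-distrib-+ {N} _ _) ⟩
        ∑[ v < N ] (𝟙 (not (typical v)) + 𝟙 (inClass p v ∧ used v) + crossNonAdjacent h v + crossNonAdjacent a v)
          + antiDegree b + C
          ≡⟨ cong (λ x → x + antiDegree b + C) (∑-distrib-+ {N} _ _) ⟩
        ∑[ v < N ] (𝟙 (not (typical v)) + 𝟙 (inClass p v ∧ used v) + crossNonAdjacent h v)
          + antiDegree a + antiDegree b + C
          ≡⟨ cong (λ x → x + antiDegree a + antiDegree b + C) (∑-distrib-+ {N} _ _) ⟩
        ∑[ v < N ] (𝟙 (not (typical v)) + 𝟙 (inClass p v ∧ used v))
          + antiDegree h + antiDegree a + antiDegree b + C
          ≡⟨ cong (λ x → x + antiDegree h + antiDegree a + antiDegree b + C) (∑-distrib-+ {N} _ _) ⟩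
        atypicalCount + count (λ v → inClass p v ∧ used v) + antiDegree h + antiDegree a + antiDegree b + C ∎
        where
        open ≤-Reasoning
        C : ℕ
        C = count (candidate p used h a b)

    common-neighbour : ∀ p (h a b : Fin N) (used : Fin N → Bool) → class h ≢ p → class a ≢ p → class b ≢ p →
      atypicalCount + count (λ v → inClass p v ∧ used v) + antiDegree h + antiDegree a + antiDegree b < classSize p →
      ∃ λ v → class v ≡ p × typical v ≡ true × used v ≡ false × adj G h v ≡ true × adj G a v ≡ true × adj G b v ≡ true
    common-neighbour p h a b used h∉p a∉p b∉p few = witness (count-witness (candidate p used h a b) available)
      where
      excluded : ℕ
      excluded = atypicalCount + count (λ v → inClass p v ∧ used v) + antiDegree h + antiDegree a + antiDegree b

      available : 0 < count (candidate p used h a b)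
      available = +-cancelˡ-< excluded 0 (count (candidate p used h a b))
        (subst (_< excluded + count (candidate p used h a b)) (sym (+-identityʳ excluded))
               (≤-trans few (classSize≤excluded+candidates p used h∉p a∉p b∉p)))

      witness : (∃ λ v → candidate p used h a b v ≡ true) →
        ∃ λ v → class v ≡ p × typical v ≡ true × used v ≡ false × adj G h v ≡ true × adj G a v ≡ true × adj G b v ≡ true
      witness (v , c) with ∧-true c
      ... | v∈p , c₁ with ∧-true c₁
      ... | typ , c₂ with ∧-true c₂
      ... | unused , c₃ with ∧-true c₃
      ... | hv , c₄ with ∧-true c₄
      ... | av , bv = v , isYes-true (class v ≟ p) v∈p , typ , not-true unused , hv , av , bv

-- Greedy construction of the rim

setAt : ∀ {A : Set} → (ℕ → A) → ℕ → A → ℕ → A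
setAt x K v k = if ⌊ k ≟ K ⌋ then v else x k

setAt-≡ : ∀ {A : Set} (x : ℕ → A) K v → setAt x K v K ≡ v
setAt-≡ x K v with K ≟ K
... | yes _  = refl
... | no K≢K = ⊥-elim (K≢K refl)

setAt-≢ : ∀ {A : Set} (x : ℕ → A) K v {k} → k ≢ K → setAt x K v k ≡ x k
setAt-≢ x K v {k} k≢K with k ≟ K
... | yes k≡K = ⊥-elim (k≢K k≡K)
... | no  _   = refl

usedBefore : ∀ {n} → (ℕ → Fin n) → ℕ → Fin n → Bool
usedBefore x zero    v = false
usedBefore x (suc K) v = usedBefore x K v ∨ ⌊ x K Finₚ.≟ v ⌋

usedBefore-false : ∀ {n} (x : ℕ → Fin n) K {v} → usedBefore x K v ≡ false → ∀ k → k < K → x k ≢ v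
usedBefore-false x (suc K) {v} unused k k<1+K with usedBefore x K v in earlier | x K Finₚ.≟ v
... | false | no xK≢v with m≤n⇒m<n∨m≡n (≤-pred k<1+K)
...   | inj₁ k<K  = usedBefore-false x K earlier k k<K
...   | inj₂ refl = xK≢v

count-usedBefore : ∀ {n} (P : Fin n → Bool) (x : ℕ → Fin n) K →
  count (λ v → P v ∧ usedBefore x K v) ≤ ∑ℕ[ k < K ] 𝟙 (P (x k))
count-usedBefore {n} P x zero    = ≤-reflexive (trans (sum-cong-≗ {n} (λ v → cong 𝟙 (∧-zeroʳ (P v)))) (sum-replicate-zero n))
count-usedBefore {n} P x (suc K) = begin
  count (λ v → P v ∧ (usedBefore x K v ∨ ⌊ x K Finₚ.≟ v ⌋))
    ≤⟨ sum-mono-≤ {n} (λ v → split (P v) (usedBefore x K v) ⌊ x K Finₚ.≟ v ⌋) ⟩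
  ∑[ v < n ] (𝟙 (P v ∧ usedBefore x K v) + 𝟙 ⌊ x K Finₚ.≟ v ⌋ * 𝟙 (P v))
    ≡⟨ ∑-distrib-+ {n} _ _ ⟩
  count (λ v → P v ∧ usedBefore x K v) + ∑[ v < n ] (𝟙 ⌊ x K Finₚ.≟ v ⌋ * 𝟙 (P v))
    ≡⟨ cong (count (λ v → P v ∧ usedBefore x K v) +_) (sum-δ (x K) (𝟙 ∘ P)) ⟩
  count (λ v → P v ∧ usedBefore x K v) + 𝟙 (P (x K))
    ≤⟨ +-monoˡ-≤ (𝟙 (P (x K))) (count-usedBefore P x K) ⟩
  ∑ℕ[ k < K ] 𝟙 (P (x k)) + 𝟙 (P (x K)) ∎
  where
  open ≤-Reasoning
  split : ∀ p u e → 𝟙 (p ∧ (u ∨ e)) ≤ 𝟙 (p ∧ u) + 𝟙 e * 𝟙 p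
  split true  true  e     = s≤s z≤n
  split true  false true  = s≤s z≤n
  split true  false false = z≤n
  split false u     e     = z≤n

wheel-from-rim : ∀ {N} (G : SimpleGraph N) len (h : Fin N) (x : ℕ → Fin N) →
  (∀ k → k < len → adj G h (x k) ≡ true) →
  (∀ k → suc k < len → adj G (x k) (x (suc k)) ≡ true) →
  (∀ k → suc k ≡ len → adj G (x 0) (x k) ≡ true) →
  (∀ i j → i < len → j < len → x i ≡ x j → i ≡ j) →
  (∀ k → k < len → x k ≢ h) →
  ContainsWheel G len
wheel-from-rim {N} G len h x spoke path closing distinct off-hub = embed , embed-injective , embed-adj
  where
  embed : Fin (suc len) → Fin N
  embed zero    = h
  embed (suc a) = x (toℕ a)

  embed-injective : Injective _≡_ _≡_ embed
  embed-injective {zero}  {zero}  _ = refl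
  embed-injective {zero}  {suc b} e = ⊥-elim (off-hub (toℕ b) (Finₚ.toℕ<n b) (sym e))
  embed-injective {suc a} {zero}  e = ⊥-elim (off-hub (toℕ a) (Finₚ.toℕ<n a) e)
  embed-injective {suc a} {suc b} e = cong suc (Finₚ.toℕ-injective (distinct _ _ (Finₚ.toℕ<n a) (Finₚ.toℕ<n b) e))

  flip-adj : ∀ {u v} → adj G u v ≡ true → adj G v u ≡ true
  flip-adj {u} {v} uv = trans (SimpleGraph.sym G v u) uv

  successor : ∀ (a b : Fin len) → suc (toℕ a) ≡ toℕ b → adj G (x (toℕ a)) (x (toℕ b)) ≡ true
  successor a b a+1≡b = subst (λ k → adj G (x (toℕ a)) (x k) ≡ true) a+1≡b
                          (path (toℕ a) (subst (_< len) (sym a+1≡b) (Finₚ.toℕ<n b)))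

  wrap : ∀ (a b : Fin len) → toℕ a ≡ 0 → suc (toℕ b) ≡ len → adj G (x (toℕ a)) (x (toℕ b)) ≡ true
  wrap a b a≡0 b+1≡len = subst (λ k → adj G (x k) (x (toℕ b)) ≡ true) (sym a≡0) (closing (toℕ b) b+1≡len)

  rim-adj : ∀ a b → cycleAdj len a b ≡ true → adj G (x (toℕ a)) (x (toℕ b)) ≡ true
  rim-adj a b e with ∨-true e
  ... | inj₁ forward = successor a b (isYes-true (suc (toℕ a) ≟ toℕ b) forward)
  ... | inj₂ e₁ with ∨-true e₁
  ...   | inj₁ backward = flip-adj (successor b a (isYes-true (suc (toℕ b) ≟ toℕ a) backward))
  ...   | inj₂ e₂ with ∨-true e₂
  ...     | inj₁ closes with ∧-true closes
  ...       | a≡0 , b-last = wrap a b (isYes-true (toℕ a ≟ 0) a≡0) (isYes-true (suc (toℕ b) ≟ len) b-last)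
  rim-adj a b e | inj₂ e₁ | inj₂ e₂ | inj₂ closes with ∧-true closes
  ...       | b≡0 , a-last = flip-adj (wrap b a (isYes-true (toℕ b ≟ 0) b≡0) (isYes-true (suc (toℕ a) ≟ len) a-last))

  embed-adj : ∀ a b → wheelAdj len a b ≡ true → adj G (embed a) (embed b) ≡ true
  embed-adj zero    (suc b) _ = spoke (toℕ b) (Finₚ.toℕ<n b)
  embed-adj (suc a) zero    _ = flip-adj (spoke (toℕ a) (Finₚ.toℕ<n a))
  embed-adj (suc a) (suc b) e = rim-adj a b e

module RimConstruction {N t : ℕ} (G : SimpleGraph N) (part : Fin N → Fin t) (L D len : ℕ) (target : ℕ → ℕ) (h : Fin N) where
  open Classes G part
  open Typical L

  module _
    (hub-typical       : typical h ≡ true)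
    (hub-apart         : ∀ k → k < len → class h ≢ target k)
    (consecutive-apart : ∀ k → suc k < len → target k ≢ target (suc k))
    (closing-apart     : ∀ k → suc k ≡ len → target k ≢ target 0)
    (room              : ∀ K → K < len → ∑ℕ[ k < K ] 𝟙 ⌊ target k ≟ target K ⌋ + D ≤ classSize (target K))
    (few-exceptions    : ∀ a b → typical a ≡ true → typical b ≡ true →
                           atypicalCount + antiDegree h + antiDegree a + antiDegree b < D)
    where

    Placed : ℕ → Fin N → Set
    Placed k v = class v ≡ target k × typical v ≡ true × adj G h v ≡ true

    record PartialRim (K : ℕ) : Set where
      field
        vertex   : ℕ → Fin N
        placed   : ∀ k → k < K → Placed k (vertex k)
        linked   : ∀ k → suc k < K → adj G (vertex k) (vertex (suc k)) ≡ true
        distinct : ∀ i j → i < K → j < K → vertex i ≡ vertex j → i ≡ j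
    open PartialRim

    noRim : PartialRim 0
    noRim = record { vertex = λ _ → h ; placed = λ _ () ; linked = λ _ () ; distinct = λ _ _ () }

    -- The hub plays the predecessor of the first rim vertex.
    previous : ∀ {K} → PartialRim K → Fin N
    previous {zero}  R = h
    previous {suc K} R = vertex R K

    previous-typical : ∀ {K} (R : PartialRim K) → typical (previous R) ≡ true
    previous-typical {zero}  R = hub-typical
    previous-typical {suc K} R = proj₁ (proj₂ (placed R K ≤-refl))

    previous-apart : ∀ {K} (R : PartialRim K) → K < len → class (previous R) ≢ target K
    previous-apart {zero}  R 0<len = hub-apart 0 0<len
    previous-apart {suc K} R K<len rewrite proj₁ (placed R K ≤-refl) = consecutive-apart K K<len

    used-in-class : ∀ {K} (R : PartialRim K) p →
      count (λ v → inClass p v ∧ usedBefore (vertex R) K v) ≤ ∑ℕ[ k < K ] 𝟙 ⌊ target k ≟ p ⌋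
    used-in-class {K} R p = ≤-trans (count-usedBefore (inClass p) (vertex R) K)
      (≤-reflexive (sumℕ-cong K (λ k k<K → cong (λ c → 𝟙 ⌊ c ≟ p ⌋) (proj₁ (placed R k k<K)))))

    attach : ∀ {K} (R : PartialRim K) (v : Fin N) → Placed K v → usedBefore (vertex R) K v ≡ false →
             adj G (previous R) v ≡ true → PartialRim (suc K)
    attach {K} R v v-placed unused prev-adj =
      record { vertex = x ; placed = placed′ ; linked = linked′ ; distinct = distinct′ }
      where
      x : ℕ → Fin N
      x = setAt (vertex R) K v

      frame : ∀ k → k < K → x k ≡ vertex R k
      frame k k<K = setAt-≢ (vertex R) K v (<⇒≢ k<K)

      placed′ : ∀ k → k < suc K → Placed k (x k)
      placed′ k k<1+K with m≤n⇒m<n∨m≡n (≤-pred k<1+K)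
      ... | inj₁ k<K  rewrite frame k k<K = placed R k k<K
      ... | inj₂ refl rewrite setAt-≡ (vertex R) K v = v-placed

      linked′ : ∀ k → suc k < suc K → adj G (x k) (x (suc k)) ≡ true
      linked′ k 1+k<1+K with m≤n⇒m<n∨m≡n (≤-pred 1+k<1+K)
      ... | inj₁ 1+k<K rewrite frame k (<-trans (n<1+n k) 1+k<K) | frame (suc k) 1+k<K = linked R k 1+k<K
      ... | inj₂ refl  rewrite frame k ≤-refl | setAt-≡ (vertex R) K v = prev-adj

      fresh : ∀ k → k < K → x k ≢ x K
      fresh k k<K xk≡xK = usedBefore-false (vertex R) K unused k k<K
                            (trans (sym (frame k k<K)) (trans xk≡xK (setAt-≡ (vertex R) K v)))

      distinct′ : ∀ i j → i < suc K → j < suc K → x i ≡ x j → i ≡ j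
      distinct′ i j i<1+K j<1+K xi≡xj with m≤n⇒m<n∨m≡n (≤-pred i<1+K) | m≤n⇒m<n∨m≡n (≤-pred j<1+K)
      ... | inj₁ i<K  | inj₁ j<K  = distinct R i j i<K j<K (trans (sym (frame i i<K)) (trans xi≡xj (frame j j<K)))
      ... | inj₂ refl | inj₂ refl = refl
      ... | inj₁ i<K  | inj₂ refl = ⊥-elim (fresh i i<K xi≡xj)
      ... | inj₂ refl | inj₁ j<K  = ⊥-elim (fresh j j<K (sym xi≡xj))

    enough-room : ∀ {K} (R : PartialRim K) → K < len → ∀ b → typical b ≡ true →
      atypicalCount + count (λ v → inClass (target K) v ∧ usedBefore (vertex R) K v)
        + antiDegree h + antiDegree (previous R) + antiDegree b < classSize (target K)
    enough-room {K} R K<len b b-typical = begin-strict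
      atypicalCount + used + antiDegree h + antiDegree a + antiDegree b
        ≡⟨ rearrange atypicalCount used (antiDegree h) (antiDegree a) (antiDegree b) ⟩
      used + (atypicalCount + antiDegree h + antiDegree a + antiDegree b)
        <⟨ +-monoʳ-< used (few-exceptions a b (previous-typical R) b-typical) ⟩
      used + D
        ≤⟨ +-monoˡ-≤ D (used-in-class R (target K)) ⟩
      ∑ℕ[ k < K ] 𝟙 ⌊ target k ≟ target K ⌋ + D
        ≤⟨ room K K<len ⟩
      classSize (target K) ∎
      where
      open ≤-Reasoning
      a : Fin N
      a = previous R
      used : ℕ
      used = count (λ v → inClass (target K) v ∧ usedBefore (vertex R) K v)
      rearrange : ∀ x u y z w → x + u + y + z + w ≡ u + (x + y + z + w)
      rearrange = solve-∀

    -- b is a further vertex the new rim vertex must be adjacent to: the predecessor again,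
    -- except when closing the cycle, where it is the first rim vertex.
    extend : ∀ {K} (R : PartialRim K) → K < len → (b : Fin N) → typical b ≡ true → class b ≢ target K →
      Σ (PartialRim (suc K)) λ R′ → adj G b (vertex R′ K) ≡ true × (∀ k → k < K → vertex R′ k ≡ vertex R k)
    extend {K} R K<len b b-typical b-apart = attach-found
      (common-neighbour (target K) h (previous R) b (usedBefore (vertex R) K)
                        (hub-apart K K<len) (previous-apart R K<len) b-apart (enough-room R K<len b b-typical))
      where
      attach-found : (∃ λ v → class v ≡ target K × typical v ≡ true × usedBefore (vertex R) K v ≡ false ×
                                adj G h v ≡ true × adj G (previous R) v ≡ true × adj G b v ≡ true) →
        Σ (PartialRim (suc K)) λ R′ → adj G b (vertex R′ K) ≡ true × (∀ k → k < K → vertex R′ k ≡ vertex R k)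
      attach-found (v , v∈p , v-typical , unused , hv , av , bv) =
        attach R v (v∈p , v-typical , hv) unused av ,
        subst (λ w → adj G b w ≡ true) (sym (setAt-≡ (vertex R) K v)) bv ,
        λ k k<K → setAt-≢ (vertex R) K v (<⇒≢ k<K)

    rimUpTo : ∀ K → K ≤ len → PartialRim K
    rimUpTo zero    _     = noRim
    rimUpTo (suc K) K<len = proj₁ (extend R K<len (previous R) (previous-typical R) (previous-apart R K<len))
      where
      R : PartialRim K
      R = rimUpTo K (<⇒≤ K<len)

    closedRim : ∀ K → suc K ≡ len → Σ (PartialRim (suc K)) λ R → adj G (vertex R 0) (vertex R K) ≡ true
    closedRim zero    1≡len = ⊥-elim (closing-apart 0 1≡len refl)
    closedRim (suc K) 2+K≡len = close (extend R K<len first first-typical first-apart)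
      where
      K<len : suc K < len
      K<len = ≤-reflexive 2+K≡len
      R : PartialRim (suc K)
      R = rimUpTo (suc K) (<⇒≤ K<len)
      first : Fin N
      first = vertex R 0
      first-typical : typical first ≡ true
      first-typical = proj₁ (proj₂ (placed R 0 (s≤s z≤n)))
      first-apart : class first ≢ target (suc K)
      first-apart first∈ = closing-apart (suc K) 2+K≡len (trans (sym first∈) (proj₁ (placed R 0 (s≤s z≤n))))
      close : (Σ (PartialRim (suc (suc K))) λ R′ → adj G first (vertex R′ (suc K)) ≡ true ×
                                                   (∀ k → k < suc K → vertex R′ k ≡ vertex R k)) →
              Σ (PartialRim (suc (suc K))) λ R′ → adj G (vertex R′ 0) (vertex R′ (suc K)) ≡ true
      close (R′ , closes , frame) = R′ , subst (λ w → adj G w (vertex R′ (suc K)) ≡ true) (sym (frame 0 (s≤s z≤n))) closes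

    wheel : 0 < len → ContainsWheel G len
    wheel 0<len = subst (ContainsWheel G) 1+K≡len
      (wheel-from-rim G (suc K) h (vertex R) (λ k k<len → proj₂ (proj₂ (placed R k k<len)))
                      (linked R) closing (distinct R) off-hub)
      where
      K : ℕ
      K = pred len
      1+K≡len : suc K ≡ len
      1+K≡len = suc-pred len {{>-nonZero 0<len}}
      R : PartialRim (suc K)
      R = proj₁ (closedRim K 1+K≡len)
      closing : ∀ k → suc k ≡ suc K → adj G (vertex R 0) (vertex R k) ≡ true
      closing k refl = proj₂ (closedRim K 1+K≡len)
      off-hub : ∀ k → k < suc K → vertex R k ≢ h
      off-hub k k<len on-hub = hub-apart k (<-≤-trans k<len (≤-reflexive 1+K≡len))
                                 (trans (cong class (sym on-hub)) (proj₁ (placed R k k<len)))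

-- The lemma with integer hypotheses

slack-cancel : ∀ q {x y w n} .{{_ : NonZero q}} → q * w ≤ n → q * x + n ≤ q * (y + w) → x ≤ y
slack-cancel q {x} {y} {w} {n} qw≤n bound = *-cancelˡ-≤ q (+-cancelʳ-≤ n (q * x) (q * y) (begin
  q * x + n      ≤⟨ bound ⟩
  q * (y + w)    ≡⟨ *-distribˡ-+ q y w ⟩
  q * y + q * w  ≤⟨ +-monoʳ-≤ (q * y) qw≤n ⟩
  q * y + n      ∎))
  where open ≤-Reasoning

capped-sum : ∀ {n a b} → n ≤ b → n + n ≤ a + b → n + n ≤ a ⊓ n + b
capped-sum {n} {a} {b} n≤b 2n≤a+b with ≤-total a n
... | inj₁ a≤n rewrite m≤n⇒m⊓n≡m a≤n = 2n≤a+b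
... | inj₂ n≤a rewrite m≥n⇒m⊓n≡n n≤a = +-monoʳ-≤ n n≤b

minOrder : ℕ → ℕ
minOrder q = 3 * (q * q)

typicality : ℕ → ℕ
typicality q = 10 * minOrder q

module DenseMultipartite {N m : ℕ} (G : SimpleGraph N) (part : Fin N → Fin (suc (suc m))) (q n : ℕ)
  (t≤q          : suc (suc m) ≤ q)
  (n≥n₀         : minOrder q ≤ n)
  (N≤3n         : N ≤ 3 * n)
  (N>0          : 0 < N)
  (V₁-large     : N ≤ q * Classes.classSize G part 0)
  (sorted       : ∀ p p′ → p ≤ p′ → p′ < suc (suc m) → Classes.classSize G part p ≤ Classes.classSize G part p′)
  (upper-large  : q * (n + n) + n ≤ q * ∑ℕ[ r < suc m ] Classes.classSize G part (suc r))
  (middle-large : q * n + n ≤ q * ∑ℕ[ r < m ] Classes.classSize G part (suc r))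
  (sparse       : ∀ (i j : Fin (suc (suc m))) → toℕ i < toℕ j →
                    typicality q * typicality q * Classes.nonEdges G part (toℕ i) (toℕ j) ≤
                    Classes.classSize G part (toℕ i) * Classes.classSize G part (toℕ j))
  where
  open Classes G part

  q>0 : 0 < q
  q>0 = ≤-trans (s≤s z≤n) t≤q

  instance
    q-nonZero : NonZero q
    q-nonZero = >-nonZero q>0

  Z L : ℕ
  Z = minOrder q
  L = typicality q

  instance
    Z-nonZero : NonZero Z
    Z-nonZero = >-nonZero (≤-trans q>0 (≤-trans (m≤m*n q q) (m≤n*m (q * q) 3)))

  D : ℕ
  D = N / Z

  q<Z : q < Z
  q<Z = begin-strict
    q                      ≤⟨ m≤m*n q q ⟩
    q * q                  <⟨ m<m+n (q * q) (≤-trans q>0 (m≤m*n q q)) ⟩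
    q * q + q * q          ≤⟨ m≤m+n (q * q + q * q) (q * q) ⟩
    q * q + q * q + q * q  ≡⟨ thrice (q * q) ⟩
    Z                      ∎
    where
    open ≤-Reasoning
    thrice : ∀ x → x + x + x ≡ 3 * x
    thrice = solve-∀

  q<L : q < L
  q<L = <-≤-trans q<Z (m≤n*m Z 10)

  N<D*Z+Z : N < D * Z + Z
  N<D*Z+Z = begin-strict
    N              ≡⟨ m≡m%n+[m/n]*n N Z ⟩
    N % Z + D * Z  <⟨ +-monoˡ-< (D * Z) (m%n<n N Z) ⟩
    Z + D * Z      ≡⟨ +-comm Z (D * Z) ⟩
    D * Z + Z      ∎
    where open ≤-Reasoning

  q*q*D≤n : q * q * D ≤ n
  q*q*D≤n = *-cancelˡ-≤ 3 (begin
    3 * (q * q * D)  ≡⟨ reorder q D ⟩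
    D * Z            ≤⟨ m/n*n≤m N Z ⟩
    N                ≤⟨ N≤3n ⟩
    3 * n            ∎)
    where
    open ≤-Reasoning
    reorder : ∀ q D → 3 * (q * q * D) ≡ D * (3 * (q * q))
    reorder = solve-∀

  N≡ : N ≡ classSize 0 + ∑ℕ[ r < suc m ] classSize (suc r)
  N≡ = trans (sym sum-classSize) (cong (classSize 0 +_) (sum-toℕ (suc m) (classSize ∘ suc)))

  2n≤N : n + n ≤ N
  2n≤N = begin
    n + n                                            ≤⟨ *-cancelˡ-≤ q (≤-trans (m≤m+n (q * (n + n)) n) upper-large) ⟩
    ∑ℕ[ r < suc m ] classSize (suc r)                ≤⟨ m≤n+m _ (classSize 0) ⟩
    classSize 0 + ∑ℕ[ r < suc m ] classSize (suc r)  ≡⟨ N≡ ⟨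
    N                                                ∎
    where open ≤-Reasoning

  V₁>0 : 0 < classSize 0
  V₁>0 = n≢0⇒n>0 λ V₁≡0 → <⇒≱ N>0 (≤-trans V₁-large (≤-reflexive (trans (cong (q *_) V₁≡0) (*-zeroʳ q))))

  D<V₁ : D < classSize 0
  D<V₁ = *-cancelʳ-< Z D (classSize 0) (begin-strict
    D * Z            ≤⟨ m/n*n≤m N Z ⟩
    N                ≤⟨ V₁-large ⟩
    q * classSize 0  <⟨ *-monoˡ-< (classSize 0) {{>-nonZero V₁>0}} q<Z ⟩
    Z * classSize 0  ≡⟨ *-comm Z (classSize 0) ⟩
    classSize 0 * Z  ∎)
    where open ≤-Reasoning

  D≤classSize : ∀ p → p < suc (suc m) → D ≤ classSize p
  D≤classSize p p<t = ≤-trans (<⇒≤ D<V₁) (sorted 0 p z≤n p<t)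

  -- Colour 0 is the largest class, the last one; colour r ≥ 1 is class r.
  classOf : ℕ → ℕ
  classOf zero    = suc m
  classOf (suc r) = suc r

  classOf<t : ∀ r → r ≤ m → classOf r < suc (suc m)
  classOf<t zero    _   = ≤-refl
  classOf<t (suc r) r<m = s≤s (m≤n⇒m≤1+n r<m)

  classOf≢0 : ∀ r → classOf r ≢ 0
  classOf≢0 zero    ()
  classOf≢0 (suc r) ()

  classOf-injective : ∀ {r r′} → r ≤ m → r′ ≤ m → classOf r ≡ classOf r′ → r ≡ r′
  classOf-injective {zero}  {zero}   _   _    _ = refl
  classOf-injective {zero}  {suc r′} _   r′<m e = ⊥-elim (<-irrefl (sym e) (s≤s r′<m))
  classOf-injective {suc r} {zero}   r<m _    e = ⊥-elim (<-irrefl e (s≤s r<m))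
  classOf-injective {suc r} {suc r′} _   _    e = e

  classOf-≟ : ∀ {r r′} → r ≤ m → r′ ≤ m → ⌊ classOf r ≟ classOf r′ ⌋ ≡ ⌊ r ≟ r′ ⌋
  classOf-≟ {r} {r′} r≤m r′≤m with classOf r ≟ classOf r′ | r ≟ r′
  ... | yes _   | yes _    = refl
  ... | no  _   | no  _    = refl
  ... | yes c≡c | no  r≢r′ = ⊥-elim (r≢r′ (classOf-injective r≤m r′≤m c≡c))
  ... | no  c≢c | yes refl = ⊥-elim (c≢c refl)

  capacity : ℕ → ℕ
  capacity r = classSize (classOf r) ∸ D

  capacity+D : ∀ r → r ≤ m → capacity r + D ≡ classSize (classOf r)
  capacity+D r r≤m = m∸n+n≡m (D≤classSize (classOf r) (classOf<t r r≤m))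

  capacity-sorted : ∀ r → r < m → capacity (suc r) ≤ capacity 0
  capacity-sorted r r<m = ∸-monoˡ-≤ D (sorted (suc r) (suc m) (s≤s (<⇒≤ r<m)) ≤-refl)

  suc-m≤q : suc m ≤ q
  suc-m≤q = ≤-trans (n≤1+n (suc m)) t≤q

  q*[m*D]≤n : ∀ {k} → k ≤ suc m → q * (k * D) ≤ n
  q*[m*D]≤n k≤1+m = ≤-trans (*-monoʳ-≤ q (*-monoˡ-≤ D (≤-trans k≤1+m suc-m≤q)))
                            (≤-trans (≤-reflexive (sym (*-assoc q q D))) q*q*D≤n)

  middleCapacity : ℕ
  middleCapacity = ∑ℕ[ r < m ] capacity (suc r)

  middleCapacity+m*D : middleCapacity + m * D ≡ ∑ℕ[ r < m ] classSize (suc r)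
  middleCapacity+m*D = sumℕ-∸ m (classSize ∘ suc) D
                         (λ r r<m → D≤classSize (suc r) (s≤s (m≤n⇒m≤1+n r<m)))

  n≤middleCapacity : n ≤ middleCapacity
  n≤middleCapacity = slack-cancel q (q*[m*D]≤n (n≤1+n m))
    (subst (λ s → q * n + n ≤ q * s) (sym middleCapacity+m*D) middle-large)

  2n≤capacity : n + n ≤ capacity 0 + middleCapacity
  2n≤capacity = slack-cancel q (q*[m*D]≤n ≤-refl)
    (subst (λ s → q * (n + n) + n ≤ q * s) upper≡ upper-large)
    where
    regroup : ∀ a b c d → a + b + (c + d) ≡ c + a + (d + b)
    regroup = solve-∀
    upper≡ : ∑ℕ[ r < suc m ] classSize (suc r) ≡ capacity 0 + middleCapacity + suc m * D
    upper≡ = begin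
      ∑ℕ[ r < m ] classSize (suc r) + classSize (suc m)
        ≡⟨ cong₂ _+_ (sym middleCapacity+m*D) (sym (capacity+D 0 z≤n)) ⟩
      middleCapacity + m * D + (capacity 0 + D)
        ≡⟨ regroup middleCapacity (m * D) (capacity 0) D ⟩
      capacity 0 + middleCapacity + suc m * D ∎
      where open ≡-Reasoning

  n>0 : 0 < n
  n>0 = ≤-trans (≤-trans q>0 (m≤m*n q q)) (≤-trans (m≤n*m (q * q) 3) n≥n₀)

  schedule : CyclicSchedule (n + n) m capacity
  schedule = cyclicSchedule n m capacity n>0 capacity-sorted (capped-sum n≤middleCapacity 2n≤capacity)
  open CyclicSchedule schedule

  target : ℕ → ℕ
  target = classOf ∘ colour

  open Typical L

  L*atypical≤N : L * atypicalCount ≤ N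
  L*atypical≤N = atypicalCount-bound N>0 (antiDegree-sum-bound (L * L) sparse)

  atypical<V₁ : atypicalCount < classSize 0
  atypical<V₁ = *-cancelˡ-< L atypicalCount (classSize 0) (begin-strict
    L * atypicalCount  ≤⟨ L*atypical≤N ⟩
    N                  ≤⟨ V₁-large ⟩
    q * classSize 0    <⟨ *-monoˡ-< (classSize 0) {{>-nonZero V₁>0}} q<L ⟩
    L * classSize 0    ∎)
    where open ≤-Reasoning

  hub : ∃ λ h → class h ≡ 0 × typical h ≡ true
  hub = typical-member (count-witness (λ v → inClass 0 v ∧ typical v) typical-in-V₁)
    where
    typical-in-V₁ : 0 < count (λ v → inClass 0 v ∧ typical v)
    typical-in-V₁ = +-cancelʳ-< atypicalCount 0 (count (λ v → inClass 0 v ∧ typical v))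
                      (<-≤-trans atypical<V₁ (count-split (inClass 0) typical))
    typical-member : (∃ λ h → (inClass 0 h ∧ typical h) ≡ true) → ∃ λ h → class h ≡ 0 × typical h ≡ true
    typical-member (h , e) = h , isYes-true (class h ≟ 0) (proj₁ (∧-true e)) , proj₂ (∧-true e)

  L≤5N : L ≤ 5 * N
  L≤5N = begin
    10 * Z       ≤⟨ *-monoʳ-≤ 10 n≥n₀ ⟩
    10 * n       ≡⟨ halve n ⟩
    5 * (n + n)  ≤⟨ *-monoʳ-≤ 5 2n≤N ⟩
    5 * N        ∎
    where
    open ≤-Reasoning
    halve : ∀ n → 10 * n ≡ 5 * (n + n)
    halve = solve-∀

  4N<L*D : 4 * N < L * D
  4N<L*D = +-cancelʳ-< L (4 * N) (L * D) (begin-strict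
    4 * N + L         ≤⟨ +-monoʳ-≤ (4 * N) L≤5N ⟩
    4 * N + 5 * N     ≤⟨ ≤-reflexive (nine N) ⟩
    9 * N             ≤⟨ *-monoˡ-≤ N {9} {10} (n≤1+n 9) ⟩
    10 * N            <⟨ *-monoʳ-< 10 N<D*Z+Z ⟩
    10 * (D * Z + Z)  ≡⟨ expand D Z ⟩
    L * D + L         ∎)
    where
    open ≤-Reasoning
    nine : ∀ N → 4 * N + 5 * N ≡ 9 * N
    nine = solve-∀
    expand : ∀ D Z → 10 * (D * Z + Z) ≡ 10 * Z * D + 10 * Z
    expand = solve-∀

  few-exceptions : ∀ h a b → typical h ≡ true → typical a ≡ true → typical b ≡ true →
                   atypicalCount + antiDegree h + antiDegree a + antiDegree b < D
  few-exceptions h a b h-typical a-typical b-typical =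
    *-cancelˡ-< L (atypicalCount + antiDegree h + antiDegree a + antiDegree b) D (begin-strict
      L * (atypicalCount + antiDegree h + antiDegree a + antiDegree b)
        ≡⟨ distrib L atypicalCount (antiDegree h) (antiDegree a) (antiDegree b) ⟩
      L * atypicalCount + L * antiDegree h + L * antiDegree a + L * antiDegree b
        ≤⟨ +-mono-≤ (+-mono-≤ (+-mono-≤ L*atypical≤N (typical-antiDegree h-typical))
                              (typical-antiDegree a-typical)) (typical-antiDegree b-typical) ⟩
      N + N + N + N
        ≡⟨ four N ⟩
      4 * N
        <⟨ 4N<L*D ⟩
      L * D ∎)
    where
    open ≤-Reasoning
    distrib : ∀ l x y z w → l * (x + y + z + w) ≡ l * x + l * y + l * z + l * w
    distrib = solve-∀
    four : ∀ N → N + N + N + N ≡ 4 * N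
    four = solve-∀

  room : ∀ K → K < n + n → ∑ℕ[ k < K ] 𝟙 ⌊ target k ≟ target K ⌋ + D ≤ classSize (target K)
  room K K<2n = begin
    ∑ℕ[ k < K ] 𝟙 ⌊ target k ≟ target K ⌋ + D
      ≡⟨ cong (_+ D) (sumℕ-cong K (λ k _ → cong 𝟙 (classOf-≟ (colour≤ k) (colour≤ K)))) ⟩
    ∑ℕ[ k < K ] 𝟙 ⌊ colour k ≟ colour K ⌋ + D
      ≤⟨ +-monoˡ-≤ D (sumℕ-monoˡ-≤ (λ k → 𝟙 ⌊ colour k ≟ colour K ⌋) (<⇒≤ K<2n)) ⟩
    ∑ℕ[ k < n + n ] 𝟙 ⌊ colour k ≟ colour K ⌋ + D
      ≤⟨ +-monoˡ-≤ D (withinCapacity (colour K)) ⟩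
    capacity (colour K) + D
      ≡⟨ capacity+D (colour K) (colour≤ K) ⟩
    classSize (target K) ∎
    where open ≤-Reasoning

  target-apart : ∀ k k′ → colour k ≢ colour k′ → target k ≢ target k′
  target-apart k k′ different same = different (classOf-injective (colour≤ k) (colour≤ k′) same)

  wheel : ContainsWheel G (n + n)
  wheel = RimConstruction.wheel G part L D (n + n) target h h-typical
            (λ k _ h∈ → classOf≢0 (colour k) (trans (sym h∈) h∈V₁))
            (λ k 1+k<2n → target-apart k (suc k) (proper k 1+k<2n))
            (λ k 1+k≡2n → target-apart k 0 (closing k 1+k≡2n))
            room
            (λ a b → few-exceptions h a b h-typical)
            (≤-trans n>0 (m≤m+n n n))
    where
    h : Fin N
    h = proj₁ hub
    h∈V₁ : class h ≡ 0
    h∈V₁ = proj₁ (proj₂ hub)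
    h-typical : typical h ≡ true
    h-typical = proj₂ (proj₂ hub)

-- From rational to integer hypotheses

ℕtoℚ≡mkℚ : ∀ n → ℕtoℚ n ≡ mkℚ (ℤ.+ n) 0 (coprime-sym (1-coprimeTo n))
ℕtoℚ≡mkℚ n = ℚ.normalize-coprime (coprime-sym (1-coprimeTo n))

ℕtoℚ-+ : ∀ a b → ℕtoℚ (a + b) ≡ ℕtoℚ a +ℚ ℕtoℚ b
ℕtoℚ-+ a b rewrite ℕtoℚ≡mkℚ a | ℕtoℚ≡mkℚ b =
  cong (_/ℚ 1) (sym (cong₂ ℤ._+_ (ℤ.*-identityʳ (ℤ.+ a)) (ℤ.*-identityʳ (ℤ.+ b))))

ℕtoℚ-* : ∀ a b → ℕtoℚ (a * b) ≡ ℕtoℚ a *ℚ ℕtoℚ b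
ℕtoℚ-* a b rewrite ℕtoℚ≡mkℚ a | ℕtoℚ≡mkℚ b = cong (_/ℚ 1) (ℤ.pos-* a b)

ℕtoℚ-cancel-≤ : ∀ {a b} → ℕtoℚ a ≤ℚ ℕtoℚ b → a ≤ b
ℕtoℚ-cancel-≤ {a} {b} a≤b rewrite ℕtoℚ≡mkℚ a | ℕtoℚ≡mkℚ b =
  ℤ.drop‿+≤+ (subst₂ ℤ._≤_ (ℤ.*-identityʳ (ℤ.+ a)) (ℤ.*-identityʳ (ℤ.+ b)) (ℚ.drop-*≤* a≤b))

ℕtoℚ-nonNeg : ∀ n → NonNegative (ℕtoℚ n)
ℕtoℚ-nonNeg n = ℚ.normalize-nonNeg n 1

archimedean : ∀ β → 0ℚ <ℚ β → ∃ λ k → 1ℚ ≤ℚ ℕtoℚ (suc k) *ℚ β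
archimedean β@(mkℚ +[1+ a ] d _) _ = d ,
  ℚ.toℚᵘ-cancel-≤ (ℚᵘ.≤-respʳ-≃ (ℚᵘ.≃-sym (ℚ.toℚᵘ-homo-* (ℕtoℚ (suc d)) β)) numerators)
  where
  numerators : toℚᵘ 1ℚ ℚᵘ.≤ toℚᵘ (ℕtoℚ (suc d)) ℚᵘ.* toℚᵘ β
  numerators rewrite ℕtoℚ≡mkℚ (suc d) =
    ℚᵘ.*≤* (ℤ.+≤+ (s≤s (subst₂ _≤_ (sym (lhs d)) (sym (rhs a d)) (m≤m+n d (a + d * a)))))
    where
    lhs : ∀ d → d + 0 * suc d + 0 * suc (d + 0 * suc d) ≡ d
    lhs = solve-∀
    rhs : ∀ a d → (a + d * suc a) * 1 ≡ d + (a + d * a)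
    rhs = solve-∀
archimedean (mkℚ +0       _ _) (*<* (ℤ.+<+ ()))
archimedean (mkℚ -[1+ _ ] _ _) (*<* ())

ℕtoℚ-pos : ∀ M .{{_ : NonZero M}} → Positive (ℕtoℚ M)
ℕtoℚ-pos M = ℚ.normalize-pos M 1

reciprocal : (M : ℕ) .{{_ : NonZero M}} → ℚ
reciprocal M = (1/ ℕtoℚ M) {{ℚ.pos⇒nonZero (ℕtoℚ M) {{ℕtoℚ-pos M}}}}

reciprocal-pos : ∀ M .{{_ : NonZero M}} → 0ℚ <ℚ reciprocal M
reciprocal-pos M = ℚ.positive⁻¹ (reciprocal M) {{ℚ.1/pos⇒pos (ℕtoℚ M) {{ℕtoℚ-pos M}}}}

below-reciprocal : ∀ M .{{_ : NonZero M}} {d} → d ≤ℚ reciprocal M → ℕtoℚ M *ℚ d ≤ℚ 1ℚ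
below-reciprocal M {d} d≤1/M = begin
  ℕtoℚ M *ℚ d             ≤⟨ ℚ.*-monoˡ-≤-nonNeg (ℕtoℚ M) {{ℕtoℚ-nonNeg M}} d≤1/M ⟩
  ℕtoℚ M *ℚ reciprocal M  ≡⟨ ℚ.*-inverseʳ (ℕtoℚ M) {{ℚ.pos⇒nonZero (ℕtoℚ M) {{ℕtoℚ-pos M}}}} ⟩
  1ℚ                      ∎
  where open ℚ.≤-Reasoning

ℚ-ring : ACR.AlmostCommutativeRing 0ℓ 0ℓ
ℚ-ring = ACR.fromCommutativeRing ℚ.+-*-commutativeRing (λ _ → nothing)

module _ (β : ℚ) (q : ℕ) (qβ≥1 : 1ℚ ≤ℚ ℕtoℚ q *ℚ β) where
  open ℚ.≤-Reasoning

  scaled-lower-bound : ∀ x y → β *ℚ ℕtoℚ x ≤ℚ ℕtoℚ y → x ≤ q * y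
  scaled-lower-bound x y βx≤y = ℕtoℚ-cancel-≤ (begin
    ℕtoℚ x                   ≡⟨ ℚ.*-identityˡ (ℕtoℚ x) ⟨
    1ℚ *ℚ ℕtoℚ x             ≤⟨ ℚ.*-monoʳ-≤-nonNeg (ℕtoℚ x) {{ℕtoℚ-nonNeg x}} qβ≥1 ⟩
    ℕtoℚ q *ℚ β *ℚ ℕtoℚ x    ≡⟨ ℚ.*-assoc (ℕtoℚ q) β (ℕtoℚ x) ⟩
    ℕtoℚ q *ℚ (β *ℚ ℕtoℚ x)  ≤⟨ ℚ.*-monoˡ-≤-nonNeg (ℕtoℚ q) {{ℕtoℚ-nonNeg q}} βx≤y ⟩
    ℕtoℚ q *ℚ ℕtoℚ y         ≡⟨ ℕtoℚ-* q y ⟨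
    ℕtoℚ (q * y)             ∎)

  scaled-linear-bound : ∀ c n s → (ℕtoℚ c +ℚ β) *ℚ ℕtoℚ n ≤ℚ ℕtoℚ s → q * (c * n) + n ≤ q * s
  scaled-linear-bound c n s bound = ℕtoℚ-cancel-≤ (begin
    ℕtoℚ (q * (c * n) + n)                             ≡⟨ trans (ℕtoℚ-+ (q * (c * n)) n)
                                                              (cong (_+ℚ ℕtoℚ n) (trans (ℕtoℚ-* q (c * n)) (cong (ℕtoℚ q *ℚ_) (ℕtoℚ-* c n)))) ⟩
    ℕtoℚ q *ℚ (ℕtoℚ c *ℚ ℕtoℚ n) +ℚ ℕtoℚ n        ≡⟨ cong (ℕtoℚ q *ℚ (ℕtoℚ c *ℚ ℕtoℚ n) +ℚ_) (ℚ.*-identityˡ (ℕtoℚ n)) ⟨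
    ℕtoℚ q *ℚ (ℕtoℚ c *ℚ ℕtoℚ n) +ℚ 1ℚ *ℚ ℕtoℚ n  ≤⟨ ℚ.+-monoʳ-≤ (ℕtoℚ q *ℚ (ℕtoℚ c *ℚ ℕtoℚ n)) (ℚ.*-monoʳ-≤-nonNeg (ℕtoℚ n) {{ℕtoℚ-nonNeg n}} qβ≥1) ⟩
    ℕtoℚ q *ℚ (ℕtoℚ c *ℚ ℕtoℚ n) +ℚ ℕtoℚ q *ℚ β *ℚ ℕtoℚ n
                                                       ≡⟨ distrib (ℕtoℚ q) (ℕtoℚ c) β (ℕtoℚ n) ⟨
    ℕtoℚ q *ℚ ((ℕtoℚ c +ℚ β) *ℚ ℕtoℚ n)  ≤⟨ ℚ.*-monoˡ-≤-nonNeg (ℕtoℚ q) {{ℕtoℚ-nonNeg q}} bound ⟩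
    ℕtoℚ q *ℚ ℕtoℚ s                     ≡⟨ ℕtoℚ-* q s ⟨
    ℕtoℚ (q * s)                         ∎)
    where
    distrib : ∀ a b c d → a *ℚ ((b +ℚ c) *ℚ d) ≡ a *ℚ (b *ℚ d) +ℚ a *ℚ c *ℚ d
    distrib = RingSolver.solve-∀ ℚ-ring

scaled-density : ∀ M d → ℕtoℚ M *ℚ d ≤ℚ 1ℚ → ∀ X E → (1ℚ -ℚ d) *ℚ ℕtoℚ X ≤ℚ ℕtoℚ E → M * X ≤ M * E + X
scaled-density M d Md≤1 X E dense = ℕtoℚ-cancel-≤ (begin
  ℕtoℚ (M * X)      ≡⟨ ℕtoℚ-* M X ⟩
  ℕtoℚ M *ℚ ℕtoℚ X  ≡⟨ split (ℕtoℚ M) d (ℕtoℚ X) ⟩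
  ℕtoℚ M *ℚ ((1ℚ -ℚ d) *ℚ ℕtoℚ X) +ℚ ℕtoℚ M *ℚ d *ℚ ℕtoℚ X
    ≤⟨ ℚ.+-mono-≤ (ℚ.*-monoˡ-≤-nonNeg (ℕtoℚ M) {{ℕtoℚ-nonNeg M}} dense) (ℚ.*-monoʳ-≤-nonNeg (ℕtoℚ X) {{ℕtoℚ-nonNeg X}} Md≤1) ⟩
  ℕtoℚ M *ℚ ℕtoℚ E +ℚ 1ℚ *ℚ ℕtoℚ X  ≡⟨ cong (ℕtoℚ M *ℚ ℕtoℚ E +ℚ_) (ℚ.*-identityˡ (ℕtoℚ X)) ⟩
  ℕtoℚ M *ℚ ℕtoℚ E +ℚ ℕtoℚ X        ≡⟨ trans (ℕtoℚ-+ (M * E) X) (cong (_+ℚ ℕtoℚ X) (ℕtoℚ-* M E)) ⟨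
  ℕtoℚ (M * E + X)                  ∎)
  where
  open ℚ.≤-Reasoning
  distrib : ∀ m e d x → m *ℚ ((e +ℚ d) *ℚ x) ≡ m *ℚ (e *ℚ x) +ℚ m *ℚ d *ℚ x
  distrib = RingSolver.solve-∀ ℚ-ring
  split : ∀ m d x → m *ℚ x ≡ m *ℚ ((1ℚ -ℚ d) *ℚ x) +ℚ m *ℚ d *ℚ x
  split m d x = begin-equality
    m *ℚ x                                ≡⟨ cong (m *ℚ_) (ℚ.*-identityˡ x) ⟨
    m *ℚ (1ℚ *ℚ x)                        ≡⟨ cong (λ y → m *ℚ (y *ℚ x)) 1-d+d≡1 ⟨
    m *ℚ ((1ℚ -ℚ d +ℚ d) *ℚ x)            ≡⟨ distrib m (1ℚ -ℚ d) d x ⟩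
    m *ℚ ((1ℚ -ℚ d) *ℚ x) +ℚ m *ℚ d *ℚ x  ∎
    where
    1-d+d≡1 : 1ℚ -ℚ d +ℚ d ≡ 1ℚ
    1-d+d≡1 = trans (ℚ.+-assoc 1ℚ (- d) d) (trans (cong (1ℚ +ℚ_) (ℚ.+-inverseˡ d)) (ℚ.+-identityʳ 1ℚ))

module Hypotheses {N m : ℕ} (G : SimpleGraph N) (part : Fin N → Fin (suc (suc m)))
                  (β : ℚ) (q : ℕ) (qβ≥1 : 1ℚ ≤ℚ ℕtoℚ q *ℚ β) where
  open Classes G part

  V₁-scaled :
    ((i : Fin (suc (suc m))) → toℕ i ≡ 0 → β *ℚ ℕtoℚ N ≤ℚ ℕtoℚ (partSize part i)) → N ≤ q * classSize 0
  V₁-scaled V₁-large =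
    subst (λ s → N ≤ q * s) (partSize≡classSize zero) (scaled-lower-bound β q qβ≥1 N _ (V₁-large zero refl))

  classSize-sorted : ((i j : Fin (suc (suc m))) → toℕ i ≤ toℕ j → partSize part i ≤ partSize part j) →
    ∀ p p′ → p ≤ p′ → p′ < suc (suc m) → classSize p ≤ classSize p′
  classSize-sorted sorted p p′ p≤p′ p′<t =
    subst₂ _≤_ (size≡ p<t) (size≡ p′<t)
      (sorted (fromℕ< p<t) (fromℕ< p′<t) (subst₂ _≤_ (sym (Finₚ.toℕ-fromℕ< p<t)) (sym (Finₚ.toℕ-fromℕ< p′<t)) p≤p′))
    where
    p<t : p < suc (suc m)
    p<t = ≤-<-trans p≤p′ p′<t
    size≡ : ∀ {r} (r<t : r < suc (suc m)) → partSize part (fromℕ< r<t) ≡ classSize r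
    size≡ r<t = trans (partSize≡classSize (fromℕ< r<t)) (cong classSize (Finₚ.toℕ-fromℕ< r<t))

  upper-sum : ΣFin (suc (suc m)) (λ i → if1 (1 ≤ᵇ' toℕ i) (partSize part i)) ≡ ∑ℕ[ r < suc m ] classSize (suc r)
  upper-sum = begin
    ΣFin (suc (suc m)) (λ i → if1 (1 ≤ᵇ' toℕ i) (partSize part i))
      ≡⟨ ΣFin≡sum (suc (suc m)) (λ i → if1 (1 ≤ᵇ' toℕ i) (partSize part i)) ⟩
    ∑[ i < suc m ] partSize part (suc i)
      ≡⟨ sum-cong-≗ {suc m} (λ i → partSize≡classSize (suc i)) ⟩
    ∑[ i < suc m ] classSize (suc (toℕ i))
      ≡⟨ sum-toℕ (suc m) (classSize ∘ suc) ⟩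
    ∑ℕ[ r < suc m ] classSize (suc r) ∎
    where open ≡-Reasoning

  middle-sum : ΣFin (suc (suc m)) (λ i → if1 (1 ≤ᵇ' toℕ i) (if1 (suc (suc (toℕ i)) ≤ᵇ' suc (suc m)) (partSize part i)))
               ≡ ∑ℕ[ r < m ] classSize (suc r)
  middle-sum = begin
    ΣFin (suc (suc m)) (λ i → if1 (1 ≤ᵇ' toℕ i) (if1 (suc (suc (toℕ i)) ≤ᵇ' suc (suc m)) (partSize part i)))
      ≡⟨ ΣFin≡sum (suc (suc m)) (λ i → if1 (1 ≤ᵇ' toℕ i) (if1 (suc (suc (toℕ i)) ≤ᵇ' suc (suc m)) (partSize part i))) ⟩
    ∑[ i < suc m ] if1 (suc (suc (suc (toℕ i))) ≤ᵇ' suc (suc m)) (partSize part (suc i))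
      ≡⟨ sum-cong-≗ {suc m} (λ i → cong (if1 (suc (suc (suc (toℕ i))) ≤ᵇ' suc (suc m))) (partSize≡classSize (suc i))) ⟩
    ∑[ i < suc m ] middle (toℕ i)
      ≡⟨ sum-toℕ (suc m) middle ⟩
    ∑ℕ[ r < m ] middle r + middle m
      ≡⟨ cong₂ _+_ (sumℕ-cong m inside) last-excluded ⟩
    ∑ℕ[ r < m ] classSize (suc r) + 0
      ≡⟨ +-identityʳ _ ⟩
    ∑ℕ[ r < m ] classSize (suc r) ∎
    where
    open ≡-Reasoning
    middle : ℕ → ℕ
    middle r = if1 (suc (suc (suc r)) ≤ᵇ' suc (suc m)) (classSize (suc r))
    inside : ∀ r → r < m → middle r ≡ classSize (suc r)
    inside r r<m with suc (suc (suc r)) ≤? suc (suc m)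
    ... | yes _      = refl
    ... | no  r+3≰m+2 = ⊥-elim (r+3≰m+2 (s≤s (s≤s r<m)))
    last-excluded : middle m ≡ 0
    last-excluded with suc (suc (suc m)) ≤? suc (suc m)
    ... | yes m+3≤m+2 = ⊥-elim (<-irrefl refl m+3≤m+2)
    ... | no  _       = refl

  upper-scaled : ∀ n →
    (ℕtoℚ 2 +ℚ β) *ℚ ℕtoℚ n ≤ℚ ℕtoℚ (ΣFin (suc (suc m)) (λ i → if1 (1 ≤ᵇ' toℕ i) (partSize part i))) →
    q * (n + n) + n ≤ q * ∑ℕ[ r < suc m ] classSize (suc r)
  upper-scaled n upper = subst₂ (λ x s → q * x + n ≤ q * s) (cong (n +_) (+-identityʳ n)) upper-sum
                                    (scaled-linear-bound β q qβ≥1 2 n _ upper)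

  middle-scaled : ∀ n →
    (1ℚ +ℚ β) *ℚ ℕtoℚ n ≤ℚ
      ℕtoℚ (ΣFin (suc (suc m)) (λ i → if1 (1 ≤ᵇ' toℕ i) (if1 (suc (suc (toℕ i)) ≤ᵇ' suc (suc m)) (partSize part i)))) →
    q * n + n ≤ q * ∑ℕ[ r < m ] classSize (suc r)
  middle-scaled n middle = subst₂ (λ x s → q * x + n ≤ q * s) (+-identityʳ n) middle-sum
                                      (scaled-linear-bound β q qβ≥1 1 n _ middle)

  sparse-scaled : ∀ M d → ℕtoℚ M *ℚ d ≤ℚ 1ℚ →
    ((i j : Fin (suc (suc m))) → toℕ i < toℕ j →
      (1ℚ -ℚ d) *ℚ ℕtoℚ (partSize part i * partSize part j) ≤ℚ ℕtoℚ (edgesBetween G part i j)) →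
    ∀ (i j : Fin (suc (suc m))) → toℕ i < toℕ j →
      M * nonEdges (toℕ i) (toℕ j) ≤ classSize (toℕ i) * classSize (toℕ j)
  sparse-scaled M d Md≤1 dense i j i<j = +-cancelˡ-≤ (M * edges p p′) _ _ (begin
    M * edges p p′ + M * nonEdges p p′  ≡⟨ *-distribˡ-+ M (edges p p′) (nonEdges p p′) ⟨
    M * (edges p p′ + nonEdges p p′)    ≡⟨ cong (M *_) (classSize-* p p′) ⟨
    M * (classSize p * classSize p′)       ≤⟨ subst₂ (λ X E → M * X ≤ M * E + X)
                                                 (cong₂ _*_ (partSize≡classSize i) (partSize≡classSize j))
                                                 (edgesBetween≡edges i j)
                                                 (scaled-density M d Md≤1 _ _ (dense i j i<j)) ⟩
    M * edges p p′ + classSize p * classSize p′ ∎)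
    where
    open ≤-Reasoning
    p p′ : ℕ
    p  = toℕ i
    p′ = toℕ j

lemma3p12 : (t : ℕ) → 3 ≤ t →
    (β : ℚ) → 0ℚ <ℚ β → β *ℚ ℕtoℚ t ≤ℚ 1ℚ →
    Σ ℚ λ α₀ → 0ℚ <ℚ α₀ × ((α : ℚ) → 0ℚ <ℚ α → α ≤ℚ α₀ →
    Σ ℚ λ d₀ → 0ℚ <ℚ d₀ × ((d : ℚ) → 0ℚ <ℚ d → d ≤ℚ d₀ →
    Σ ℕ λ n₀ → 0 < n₀ × ((n N : ℕ) → 0 < n → 0 < N → n₀ ≤ n → N ≤ 3 * n →
    (G : SimpleGraph N) (part : Fin N → Fin t) → IsPartite G t part →
    ((i : Fin t) → toℕ i ≡ 0 → β *ℚ ℕtoℚ N ≤ℚ ℕtoℚ (partSize part i)) →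
    ((i j : Fin t) → toℕ i ≤ toℕ j → partSize part i ≤ partSize part j) →
    (ℕtoℚ 2 +ℚ β) *ℚ ℕtoℚ n ≤ℚ
      ℕtoℚ (ΣFin t (λ i → if1 (1 ≤ᵇ' toℕ i) (partSize part i))) →
    (1ℚ +ℚ β) *ℚ ℕtoℚ n ≤ℚ
      ℕtoℚ (ΣFin t (λ i → if1 (1 ≤ᵇ' toℕ i) (if1 (suc (suc (toℕ i)) ≤ᵇ' t) (partSize part i)))) →
    ((i j : Fin t) → toℕ i < toℕ j →
      (1ℚ -ℚ d) *ℚ ℕtoℚ (partSize part i * partSize part j) ≤ℚ ℕtoℚ (edgesBetween G part i j)) →
    ContainsWheel G (2 * n))))
lemma3p12 zero                ()
lemma3p12 (suc zero)          (s≤s ())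
lemma3p12 (suc (suc zero))    (s≤s (s≤s ()))
lemma3p12 (suc (suc (suc k))) _ β β>0 βt≤1 =
  -- α occurs in no hypothesis, so any α₀ will do.
  1ℚ , ℚ.positive⁻¹ 1ℚ , λ _ _ _ →
  reciprocal M , reciprocal-pos M , λ d _ d≤d₀ →
  -- Neither is it used that G is t-partite: rim vertices are chosen adjacent where required.
  minOrder q , s≤s z≤n , λ n N _ N>0 n≥n₀ N≤3n G part _ V₁-large sorted upper middle dense →
    let open Hypotheses G part β q qβ≥1 in
    subst (ContainsWheel G) (cong (n +_) (sym (+-identityʳ n)))
      (DenseMultipartite.wheel G part q n t≤q n≥n₀ N≤3n N>0
        (V₁-scaled V₁-large)
        (classSize-sorted sorted)
        (upper-scaled n upper)
        (middle-scaled n middle)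
        (sparse-scaled M d (below-reciprocal M d≤d₀) dense))
  where
  q : ℕ
  q = suc (proj₁ (archimedean β β>0))
  qβ≥1 : 1ℚ ≤ℚ ℕtoℚ q *ℚ β
  qβ≥1 = proj₂ (archimedean β β>0)
  M : ℕ
  M = typicality q * typicality q
  t≤q : suc (suc (suc k)) ≤ q
  t≤q = subst (suc (suc (suc k)) ≤_) (*-identityʳ q) (scaled-lower-bound β q qβ≥1 (suc (suc (suc k))) 1 βt≤1)
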